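{- Let $f:\mathfrak A\to\mathfrak B$ be a (total) team map. The following are equivalent: (1) $f$ is an elementary team embedding; (2) $f$ is a team embedding and for every formula $\phi(v_0,\dots,v_n)$ of $\mathrm{FOT}$ and every $X\subseteq\mathfrak A^n$, if $\mathfrak B\models_{f(X)}\exists^1v_n\phi$, then there is $a\in\mathfrak A$ such that $\mathfrak B\models_{f(X)(f(a)/n)}\phi$.
   Context: For a structure $\mathfrak A$, $\mathcal R(\mathfrak A)=\bigcup_n\mathcal P(\mathfrak A^n)$. A team map $f:\mathfrak A\to\mathfrak B$ is an arity-preserving function $\mathcal R(\mathfrak A)\to\mathcal R(\mathfrak B)$ whose range is closed (contains $\emptyset$, all $\mathfrak B^n$, the diagonal, interpretations of symbols (graphs for functions, $\{c\}$ for constants), and is closed under $\cap$, Cartesian product $\times$ by concatenation, and coordinate maps $\mathrm{Pr}_{\vec\imath}$). A team embedding is a team map that: preserves and reflects emptiness and fullness ($X=\mathfrak A^n$ iff $f(X)=\mathfrak B^n$), singletonhood and inclusion; commutes with $\times$ and all $\mathrm{Pr}_{\vec\imath}$; and maps the diagonal and interpretations of symbols in $\mathfrak A$ to those in $\mathfrak B$. An elementary team embedding is a team map commuting with $\times$ such that for all $\mathrm{FOT}$-formulas $\phi(v_0,\dots,v_{n-1})$ and $X\subseteq\mathfrak A^n$, $\mathfrak A\models_X\phi$ iff $\mathfrak B\models_{f(X)}\phi$. For $a\in\mathfrak A$, $f(a)$ is the unique element of $f(\{a\})$. For $X\subseteq\mathfrak A^n$ and $a$, $X(a/n)=X\times\{a\}$.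 $\mathrm{FOT}$: syntax $\lambda\mid\vec x\subseteq\vec y\mid{=}(\vec x)\mid{\sim}\phi\mid\phi\wedge\phi\mid\phi\,\underline\vee\,\phi\mid\exists^1x\phi\mid\forall^1x\phi$ ($\lambda$ first-order atomic); in a team $X$: $\lambda$ iff true at every assignment; $\vec x\subseteq\vec y$ iff $X[\vec x]\subseteq X[\vec y]$; ${=}(\vec x)$ iff $|X[\vec x]|\le1$; ${\sim}\phi$ iff $X=\emptyset$ or $\phi$ fails; $\wedge,\underline\vee$ classical; $\exists^1x\phi$ iff $\phi$ holds in $\{s(a/x):s\in X\}$ for some element $a$, $\forall^1$ for every $a$. An $n$-ary relation $X$ is identified with the team $\{\{(v_i,a_i):i<n\}:\vec a\in X\}$. -}

module Defs where

open import Level using (0ℓ) renaming (suc to lsuc)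
open import Data.Nat using (ℕ; zero; suc; _+_; _≟_)
open import Data.Fin using (Fin; toℕ) renaming (zero to fzero; suc to fsuc)
open import Data.Vec using (Vec; []; _∷_; lookup; tabulate; take; drop; init; last; _[_]≔_; head; tail)
import Data.Vec as Vec
open import Data.Maybe using (Maybe; just; nothing)
import Data.Maybe as Maybe
open import Data.Product using (Σ; _×_; _,_)
open import Data.Sum using (_⊎_)
open import Data.Empty using (⊥)
open import Relation.Nullary using (¬_; yes; no)
open import Relation.Binary.PropositionalEquality using (_≡_)
open import Function.Bundles using (_⇔_)

-- Signatures, terms, FOT formulas (variables are v₀, v₁, … ≅ ℕ)
-- constants are 0-ary function symbols

record Signature : Set₁ where
  field
    RelSym  : Set
    rarity  : RelSym → ℕ
    FunSym  : Set
    farity  : FunSym → ℕ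
open Signature public

data Term (σ : Signature) : Set where
  var : ℕ → Term σ
  app : (F : FunSym σ) → Vec (Term σ) (farity σ F) → Term σ

data Formula (σ : Signature) : Set where
  eqAt   : Term σ → Term σ → Formula σ
  relAt  : (R : RelSym σ) → Vec (Term σ) (rarity σ R) → Formula σ
  incl   : ∀ {k} → Vec ℕ k → Vec ℕ k → Formula σ
  dep    : ∀ {k} → Vec ℕ k → Formula σ
  neg    : Formula σ → Formula σ
  conj   : Formula σ → Formula σ → Formula σ
  disj   : Formula σ → Formula σ → Formula σ                    -- φ ∨ ψ (Boolean)
  ex1    : ℕ → Formula σ → Formula σ
  all1   : ℕ → Formula σ → Formula σ

module _ {σ : Signature} where
  mutual
    VarsT : (ℕ → Set) → Term σ → Set
    VarsT P (var x) = P x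
    VarsT P (app F ts) = VarsTs P ts

    VarsTs : ∀ {k} → (ℕ → Set) → Vec (Term σ) k → Set
    VarsTs P [] = Data.Unit.⊤ where import Data.Unit
    VarsTs P (t ∷ ts) = VarsT P t × VarsTs P ts

  VarsV : ∀ {k} → (ℕ → Set) → Vec ℕ k → Set
  VarsV P [] = Data.Unit.⊤ where import Data.Unit
  VarsV P (x ∷ xs) = P x × VarsV P xs

  FreeIn : (ℕ → Set) → Formula σ → Set
  FreeIn P (eqAt t t') = VarsT P t × VarsT P t'
  FreeIn P (relAt R ts) = VarsTs P ts
  FreeIn P (incl xs ys) = VarsV P xs × VarsV P ys
  FreeIn P (dep xs) = VarsV P xs
  FreeIn P (neg φ) = FreeIn P φ
  FreeIn P (conj φ ψ) = FreeIn P φ × FreeIn P ψ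
  FreeIn P (disj φ ψ) = FreeIn P φ × FreeIn P ψ
  FreeIn P (ex1 x φ) = FreeIn (λ y → y ≡ x ⊎ P y) φ
  FreeIn P (all1 x φ) = FreeIn (λ y → y ≡ x ⊎ P y) φ

  FreeBelow : ℕ → Formula σ → Set
  FreeBelow n = FreeIn (λ y → Σ (Fin n) λ i → toℕ i ≡ y)

record Structure (σ : Signature) : Set₁ where
  field
    Carrier : Set
    relI    : (R : RelSym σ) → Vec Carrier (rarity σ R) → Set
    funI    : (F : FunSym σ) → Vec Carrier (farity σ F) → Carrier
open Structure public

Rel : Set → ℕ → Set₁
Rel A n = Vec A n → Set

module _ {A : Set} where
  _⊆_ : ∀ {n} → Rel A n → Rel A n → Set
  X ⊆ Y = ∀ v → X v → Y v

  _≐_ : ∀ {n} → Rel A n → Rel A n → Set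
  X ≐ Y = X ⊆ Y × Y ⊆ X

  ∅ : ∀ {n} → Rel A n
  ∅ _ = ⊥

  Full : ∀ n → Rel A n
  Full n _ = Data.Unit.⊤ where import Data.Unit

  IsEmpty : ∀ {n} → Rel A n → Set
  IsEmpty X = ∀ v → ¬ X v

  IsFull : ∀ {n} → Rel A n → Set
  IsFull X = ∀ v → X v

  IsSingletonOf : ∀ {n} → Rel A n → Vec A n → Set
  IsSingletonOf X a = ∀ v → (X v → v ≡ a) × (v ≡ a → X v)

  IsSingleton : ∀ {n} → Rel A n → Set
  IsSingleton X = Σ (Vec A _) λ a → IsSingletonOf X a

  sing : A → Rel A 1
  sing a v = v ≡ a ∷ []

  _∩_ : ∀ {n} → Rel A n → Rel A n → Rel A n
  (X ∩ Y) v = X v × Y v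

  _×ʳ_ : ∀ {n k} → Rel A n → Rel A k → Rel A (n + k)
  _×ʳ_ {n} X Y v = X (take n v) × Y (drop n v)

  Pr : ∀ {n k} → Vec (Fin n) k → Rel A n → Rel A k
  Pr ı X u = Σ (Vec A _) λ v → X v × u ≡ Vec.map (lookup v) ı

  Diag : Rel A 2
  Diag v = lookup v fzero ≡ lookup v (fsuc fzero)

  Graph : ∀ {k} → (Vec A k → A) → Rel A (suc k)
  Graph F v = F (init v) ≡ last v

-- Team semantics of FOT.  A team is a set of assignments over a finite
-- list of (distinct) variable names; an assignment is a tuple of values.

module Semantics {σ : Signature} (𝔄 : Structure σ) where
  private A = Carrier 𝔄

  record Team : Set₁ where
    constructor team
    field
      {dom}  : ℕ
      names  : Vec ℕ dom
      rel    : Rel A dom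

  lookupVar : ∀ {m} → Vec ℕ m → ℕ → Maybe (Fin m)
  lookupVar [] x = nothing
  lookupVar (y ∷ ys) x with x ≟ y
  ... | yes _ = just fzero
  ... | no  _ = Maybe.map fsuc (lookupVar ys x)

  mutual
    evalT : ∀ {m} → Vec ℕ m → Vec A m → Term σ → Maybe A
    evalT ns s (var x) = Maybe.map (lookup s) (lookupVar ns x)
    evalT ns s (app F ts) = Maybe.map (funI 𝔄 F) (evalTs ns s ts)

    evalTs : ∀ {m k} → Vec ℕ m → Vec A m → Vec (Term σ) k → Maybe (Vec A k)
    evalTs ns s [] = just []
    evalTs ns s (t ∷ ts) with evalT ns s t | evalTs ns s ts
    ... | just a | just as = just (a ∷ as)
    ... | _      | _       = nothing

  proj : Team → ∀ {k} → Vec ℕ k → Rel A k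
  proj (team ns X) xs u = Σ (Vec A _) λ s → X s × evalTs ns s (Vec.map var xs) ≡ just u

  holdsEq : Maybe A → Maybe A → Set
  holdsEq (just a) (just b) = a ≡ b
  holdsEq _ _ = ⊥

  holdsRel : ∀ {k} → (Vec A k → Set) → Maybe (Vec A k) → Set
  holdsRel R (just v) = R v
  holdsRel R nothing = ⊥

  update : Team → ℕ → A → Team
  update (team ns X) x a with lookupVar ns x
  ... | just i  = team ns (λ t → Σ (Vec A _) λ s → X s × t ≡ s [ i ]≔ a)
  ... | nothing = team (x ∷ ns) (λ t → X (tail t) × head t ≡ a)

  Sat : Team → Formula σ → Set
  Sat (team ns X) (eqAt t t') = ∀ s → X s → holdsEq (evalT ns s t) (evalT ns s t')
  Sat (team ns X) (relAt R ts) = ∀ s → X s → holdsRel (relI 𝔄 R) (evalTs ns s ts)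
  Sat T (incl xs ys) = proj T xs ⊆ proj T ys
  Sat T (dep xs) = ∀ u u' → proj T xs u → proj T xs u' → u ≡ u'
  Sat T (neg φ) = IsEmpty (Team.rel T) ⊎ ¬ Sat T φ
  Sat T (conj φ ψ) = Sat T φ × Sat T ψ
  Sat T (disj φ ψ) = Sat T φ ⊎ Sat T ψ
  Sat T (ex1 x φ) = Σ A λ a → Sat (update T x a) φ
  Sat T (all1 x φ) = ∀ a → Sat (update T x a) φ

  -- 𝔄 ⊨_X φ for X ⊆ Aⁿ, identified with a team on v₀ … v_{n-1}
  _⊨[_]_ : ∀ {n} → Rel A n → Formula σ → Set
  _⊨[_]_ {n} X φ = Sat (team (tabulate toℕ) X) φ
  infix 4 _⊨[_]_

open Semantics public using (_⊨[_]_)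

record Closed {σ : Signature} (𝔅 : Structure σ)
              (S : ∀ {n} → Rel (Carrier 𝔅) n → Set₁) : Set₁ where
  field
    cl-∅    : ∀ n → S (∅ {n = n})
    cl-full : ∀ n → S (Full n)
    cl-diag : S Diag
    cl-rel  : ∀ R → S (relI 𝔅 R)
    cl-fun  : ∀ F → S (Graph (funI 𝔅 F))
    cl-∩    : ∀ {n} {Y Y' : Rel _ n} → S Y → S Y' → S (Y ∩ Y')
    cl-×    : ∀ {n k} {Y : Rel _ n} {Y' : Rel _ k} → S Y → S Y' → S (Y ×ʳ Y')
    cl-Pr   : ∀ {n k} (ı : Vec (Fin n) k) {Y : Rel _ n} → S Y → S (Pr ı Y)

record TeamMap {σ : Signature} (𝔄 𝔅 : Structure σ) : Set₁ where
  field
    fmap  : ∀ {n} → Rel (Carrier 𝔄) n → Rel (Carrier 𝔅) n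
    -- f is a function on sets, so respects equality of sets
    resp  : ∀ {n} {X Y : Rel (Carrier 𝔄) n} → X ≐ Y → fmap X ≐ fmap Y
  InRange : ∀ {n} → Rel (Carrier 𝔅) n → Set₁
  InRange Y = Σ (Rel (Carrier 𝔄) _) λ X → fmap X ≐ Y
  field
    rangeClosed : Closed 𝔅 InRange
open TeamMap public

module _ {σ : Signature} {𝔄 𝔅 : Structure σ} (f : TeamMap 𝔄 𝔅) where
  private
    A = Carrier 𝔄
    B = Carrier 𝔅

  record IsTeamEmbedding : Set₁ where
    field
      emb-empty : ∀ {n} (X : Rel A n) → IsEmpty X ⇔ IsEmpty (fmap f X)
      emb-full  : ∀ {n} (X : Rel A n) → IsFull X ⇔ IsFull (fmap f X)
      emb-sing  : ∀ {n} (X : Rel A n) → IsSingleton X ⇔ IsSingleton (fmap f X)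
      emb-incl  : ∀ {n} (X Y : Rel A n) → X ⊆ Y ⇔ fmap f X ⊆ fmap f Y
      emb-×     : ∀ {n k} (X : Rel A n) (Y : Rel A k) →
                  fmap f (X ×ʳ Y) ≐ (fmap f X ×ʳ fmap f Y)
      emb-Pr    : ∀ {n k} (ı : Vec (Fin n) k) (X : Rel A n) →
                  fmap f (Pr ı X) ≐ Pr ı (fmap f X)
      emb-diag  : fmap f Diag ≐ Diag
      emb-rel   : ∀ R → fmap f (relI 𝔄 R) ≐ relI 𝔅 R
      emb-fun   : ∀ F → fmap f (Graph (funI 𝔄 F)) ≐ Graph (funI 𝔅 F)

  record IsElementaryTeamEmbedding : Set₁ where
    field
      el-×   : ∀ {n k} (X : Rel A n) (Y : Rel A k) →
               fmap f (X ×ʳ Y) ≐ (fmap f X ×ʳ fmap f Y)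
      el-sat : ∀ n (φ : Formula σ) → FreeBelow n φ → (X : Rel A n) →
               (𝔄 ⊨[ X ] φ) ⇔ (𝔅 ⊨[ fmap f X ] φ)

  -- condition (2), second half (Tarski–Vaught style); f(a) is the unique
  -- element b of f({a}), i.e. f({a}) = {b}
  TarskiVaught : Set₁
  TarskiVaught =
    ∀ n (φ : Formula σ) → FreeBelow (suc n) φ → (X : Rel A n) →
    𝔅 ⊨[ fmap f X ] ex1 n φ →
    Σ A λ a → Σ B λ b →
      IsSingletonOf (fmap f (sing a)) (b ∷ []) ×
      (𝔅 ⊨[ fmap f X ×ʳ sing b ] φ)

{-# OPTIONS --safe #-}
-- (1) ⇒ (2): every clause of a team embedding says that some FOT formula holds
-- in a team built from the relations involved: X is empty iff ∼(⊆ on the empty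
-- tuple) holds in X, inclusions and projections are inclusion atoms in X × Y,
-- singletons are the non-empty teams satisfying =(v⃗), and the diagonal, the
-- relations and the graphs are the largest teams satisfying an atom.  The
-- Tarski–Vaught condition holds because f(X × {a}) = f(X) × {f(a)}.
--
-- (2) ⇒ (1): induction on φ, over teams on arbitrary lists of variables.  The
-- assignments satisfying an atom, and the projections compared by inclusion and
-- dependence atoms, are built from the team by ∅, full relations, symbols, ∩, ×
-- and projections, all of which commute with a team embedding.  ∃¹x is reflected
-- by the Tarski–Vaught condition once the team is moved to v₀ … v_{N-1} and the
-- witness for x to a fresh variable v_N; ∀¹ follows from the ∃¹-case for ∼φ by
-- excluded middle.
module Submission where

open import Defs
open import Level using (0ℓ) renaming (suc to lsuc)
open import Data.Nat as ℕ using (ℕ; zero; suc; _+_; _≟_; _≤_; _<_)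
import Data.Nat.Properties as ℕ
open import Data.Fin as Fin using (Fin; toℕ; _↑ˡ_; _↑ʳ_)
import Data.Fin.Properties as Fin
open import Data.Vec as V using (Vec; []; _∷_; lookup; tabulate; allFin; _[_]≔_; _++_)
import Data.Vec.Properties as V
open import Data.Maybe as Maybe using (Maybe; just; nothing)
open import Data.Maybe.Properties using (just-injective; map-∘)
open import Data.Product using (Σ; _×_; _,_; proj₁; proj₂)
open import Data.Product.Function.NonDependent.Propositional using (_×-⇔_)
open import Data.Sum as Sum using (_⊎_; inj₁; inj₂)
open import Data.Sum.Function.Propositional using (_⊎-⇔_)
open import Data.Empty using (⊥-elim)
open import Data.Unit using (⊤; tt)
open import Function using (_∘_; id)
open import Function.Bundles using (_⇔_; mk⇔; Equivalence)
import Function.Properties.Equivalence as ⇔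
open import Relation.Nullary using (¬_; yes; no)
open import Relation.Nullary.Decidable using (decidable-stable)
open import Function.Related.TypeIsomorphisms using (¬-cong-⇔)
open import Relation.Binary.PropositionalEquality using (_≡_; refl; sym; trans; cong; cong₂; subst; subst₂; module ≡-Reasoning)
open import Axiom.ExcludedMiddle using (ExcludedMiddle)

open Equivalence using (to; from)

-- Reads (x⃗, y) as (y, x⃗): Graph stores the value of a function last, the
-- term graphs below store it first.
lastFirst : ∀ k → Vec (Fin (suc k)) (suc k)
lastFirst k = Fin.fromℕ k ∷ tabulate Fin.inject₁

module _ {A : Set} where

  map-lookup-tabulate : ∀ {n k} (g : Fin k → Fin n) (v : Vec A n) (w : Vec A k) →
                        (∀ j → lookup v (g j) ≡ lookup w j) → V.map (lookup v) (tabulate g) ≡ w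
  map-lookup-tabulate g v w h = begin
    V.map (lookup v) (tabulate g) ≡⟨ V.tabulate-∘ (lookup v) g ⟨
    tabulate (lookup v ∘ g)       ≡⟨ V.tabulate-cong h ⟩
    tabulate (lookup w)           ≡⟨ V.tabulate∘lookup w ⟩
    w                             ∎
    where open ≡-Reasoning

  map-lookup-allFin : ∀ {n} (v : Vec A n) → V.map (lookup v) (allFin n) ≡ v
  map-lookup-allFin v = map-lookup-tabulate id v v (λ _ → refl)

  map-lookup-++-↑ˡ : ∀ {n k j} (p : Vec A n) (q : Vec A k) (ı : Vec (Fin n) j) →
                     V.map (lookup (p ++ q)) (V.map (_↑ˡ k) ı) ≡ V.map (lookup p) ı
  map-lookup-++-↑ˡ p q ı = trans (sym (V.map-∘ _ _ ı)) (V.map-cong (V.lookup-++ˡ p q) ı)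

  map-lookup-++-↑ʳ : ∀ {n k} (p : Vec A n) (q : Vec A k) → V.map (lookup (p ++ q)) (tabulate (n ↑ʳ_)) ≡ q
  map-lookup-++-↑ʳ p q = map-lookup-tabulate _ (p ++ q) q (V.lookup-++ʳ p q)

  take-++ : ∀ {m n} (p : Vec A m) (q : Vec A n) → V.take m (p ++ q) ≡ p
  take-++ [] q = refl
  take-++ (x ∷ p) q = cong (x ∷_) (take-++ p q)

  drop-++ : ∀ {m n} (p : Vec A m) (q : Vec A n) → V.drop m (p ++ q) ≡ q
  drop-++ [] q = refl
  drop-++ (x ∷ p) q = drop-++ p q

  lookup-∷ʳ-inject₁ : ∀ {k} (w : Vec A k) c i → lookup (w V.∷ʳ c) (Fin.inject₁ i) ≡ lookup w i
  lookup-∷ʳ-inject₁ (x ∷ w) c Fin.zero = refl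
  lookup-∷ʳ-inject₁ (x ∷ w) c (Fin.suc i) = lookup-∷ʳ-inject₁ w c i

  lookup-∷ʳ-fromℕ : ∀ {k} (w : Vec A k) c → lookup (w V.∷ʳ c) (Fin.fromℕ k) ≡ c
  lookup-∷ʳ-fromℕ [] c = refl
  lookup-∷ʳ-fromℕ (x ∷ w) c = lookup-∷ʳ-fromℕ w c

  map-lookup-lastFirst : ∀ {k} (v : Vec A (suc k)) → V.map (lookup v) (lastFirst k) ≡ V.last v ∷ V.init v
  map-lookup-lastFirst {k} v with V.initLast v
  ... | w , c , refl = cong₂ _∷_ (lookup-∷ʳ-fromℕ w c) (map-lookup-tabulate _ (w V.∷ʳ c) w (lookup-∷ʳ-inject₁ w c))

module _ {A : Set} where

  ≐-refl : ∀ {n} {X : Rel A n} → X ≐ X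
  ≐-refl = (λ _ h → h) , (λ _ h → h)

  ≐-sym : ∀ {n} {X Y : Rel A n} → X ≐ Y → Y ≐ X
  ≐-sym (p , q) = q , p

  ≐-trans : ∀ {n} {X Y Z : Rel A n} → X ≐ Y → Y ≐ Z → X ≐ Z
  ≐-trans (p , q) (p' , q') = (λ v → p' v ∘ p v) , (λ v → q v ∘ q' v)

  ∩-resp-≐ : ∀ {n} {X X' Y Y' : Rel A n} → X ≐ X' → Y ≐ Y' → (X ∩ Y) ≐ (X' ∩ Y')
  ∩-resp-≐ (p , q) (p' , q') = (λ v (h , h') → p v h , p' v h') , (λ v (h , h') → q v h , q' v h')

  ×ʳ-resp-≐ : ∀ {n k} {X X' : Rel A n} {Y Y' : Rel A k} → X ≐ X' → Y ≐ Y' → (X ×ʳ Y) ≐ (X' ×ʳ Y')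
  ×ʳ-resp-≐ {n} (p , q) (p' , q') = (λ v (h , h') → p (V.take n v) h , p' (V.drop n v) h')
                                   , (λ v (h , h') → q (V.take n v) h , q' (V.drop n v) h')

  Pr-resp-≐ : ∀ {n k} (ı : Vec (Fin n) k) {X X' : Rel A n} → X ≐ X' → Pr ı X ≐ Pr ı X'
  Pr-resp-≐ ı (p , q) = (λ u (v , h , e) → v , p v h , e) , (λ u (v , h , e) → v , q v h , e)

  ⊆-resp-≐ : ∀ {n} {X X' Y Y' : Rel A n} → X ≐ X' → Y ≐ Y' → X ⊆ Y → X' ⊆ Y'
  ⊆-resp-≐ (p , q) (p' , q') inc v = p' v ∘ inc v ∘ q v

  ⊆-cong-≐ : ∀ {n} {X X' Y Y' : Rel A n} → X ≐ X' → Y ≐ Y' → X ⊆ Y ⇔ X' ⊆ Y'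
  ⊆-cong-≐ eX eY = mk⇔ (⊆-resp-≐ eX eY) (⊆-resp-≐ (≐-sym eX) (≐-sym eY))

  ×ʳ-intro : ∀ {n k} {P : Rel A n} {Q : Rel A k} (p : Vec A n) (q : Vec A k) → P p → Q q → (P ×ʳ Q) (p ++ q)
  ×ʳ-intro {P = P} {Q} p q Pp Qq = subst P (sym (take-++ p q)) Pp , subst Q (sym (drop-++ p q)) Qq

  IsSingletonOf⇒≐sing : ∀ {X : Rel A 1} {b} → IsSingletonOf X (b ∷ []) → X ≐ sing b
  IsSingletonOf⇒≐sing h = (λ v → proj₁ (h v)) , (λ v → proj₂ (h v))

  NonEmpty : ∀ {n} → Rel A n → Set
  NonEmpty X = Σ (Vec A _) X

  IsSubsingleton : ∀ {n} → Rel A n → Set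
  IsSubsingleton Z = ∀ u u' → Z u → Z u' → u ≡ u'

  IsSubsingleton-resp-≐ : ∀ {n} {X Y : Rel A n} → X ≐ Y → IsSubsingleton X → IsSubsingleton Y
  IsSubsingleton-resp-≐ (p , q) ss u u' h h' = ss u u' (q u h) (q u' h')

  IsSubsingleton-cong-≐ : ∀ {n} {X Y : Rel A n} → X ≐ Y → IsSubsingleton X ⇔ IsSubsingleton Y
  IsSubsingleton-cong-≐ e = mk⇔ (IsSubsingleton-resp-≐ e) (IsSubsingleton-resp-≐ (≐-sym e))

  subsingleton⇔empty⊎singleton : ExcludedMiddle 0ℓ → ∀ {n} (Z : Rel A n) →
                                  IsSubsingleton Z ⇔ (IsEmpty Z ⊎ IsSingleton Z)
  subsingleton⇔empty⊎singleton em Z = mk⇔ split join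
    where
    split : IsSubsingleton Z → IsEmpty Z ⊎ IsSingleton Z
    split ss with em {NonEmpty Z}
    ... | yes (u , h) = inj₂ (u , λ v → (λ h' → ss v u h' h) , (λ { refl → h }))
    ... | no ne = inj₁ (λ v h → ne (v , h))
    join : IsEmpty Z ⊎ IsSingleton Z → IsSubsingleton Z
    join (inj₁ e) u u' h h' = ⊥-elim (e u h)
    join (inj₂ (a , so)) u u' h h' = trans (proj₁ (so u) h) (sym (proj₁ (so u') h'))

  singleton⇔¬empty×subsingleton : ExcludedMiddle 0ℓ → ∀ {n} (Z : Rel A n) →
                                    IsSingleton Z ⇔ (¬ IsEmpty Z × IsSubsingleton Z)
  singleton⇔¬empty×subsingleton em Z = mk⇔
    (λ { (a , so) → (λ e → e a (proj₂ (so a) refl)) , from split (inj₂ (a , so)) })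
    (λ { (ne , ss) → Sum.[ (λ e → ⊥-elim (ne e)) , id ] (to split ss) })
    where split = subsingleton⇔empty⊎singleton em Z

  Pr-allFin : ∀ {n} (P : Rel A n) → Pr (allFin n) P ≐ P
  Pr-allFin P = (λ u (v , h , e) → subst P (sym (trans e (map-lookup-allFin v))) h)
              , (λ u h → u , h , sym (map-lookup-allFin u))

  Pr-↑ˡ-×ʳ : ∀ {n k j} (P : Rel A n) (Q : Rel A k) (ı : Vec (Fin n) j) → NonEmpty Q →
             Pr (V.map (_↑ˡ k) ı) (P ×ʳ Q) ≐ Pr ı P
  Pr-↑ˡ-×ʳ {n} {k} P Q ı (q₀ , Qq₀) = fw , bw
    where
    fw : Pr (V.map (_↑ˡ k) ı) (P ×ʳ Q) ⊆ Pr ı P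
    fw u (v , h , e) with V.splitAt n v
    ... | p , q , refl = p , proj₁ h , trans e (map-lookup-++-↑ˡ p q ı)
    bw : Pr ı P ⊆ Pr (V.map (_↑ˡ k) ı) (P ×ʳ Q)
    bw u (p , Pp , e) = p ++ q₀ , ×ʳ-intro {P = P} {Q} p q₀ Pp Qq₀ , trans e (sym (map-lookup-++-↑ˡ p q₀ ı))

  Pr-↑ʳ-×ʳ : ∀ {n k} (P : Rel A n) (Q : Rel A k) → NonEmpty P → Pr (tabulate (n ↑ʳ_)) (P ×ʳ Q) ≐ Q
  Pr-↑ʳ-×ʳ {n} P Q (p₀ , Pp₀) = fw , bw
    where
    fw : Pr (tabulate (n ↑ʳ_)) (P ×ʳ Q) ⊆ Q
    fw u (v , h , e) with V.splitAt n v
    ... | p , q , refl = subst Q (sym (trans e (map-lookup-++-↑ʳ p q))) (proj₂ h)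
    bw : Q ⊆ Pr (tabulate (n ↑ʳ_)) (P ×ʳ Q)
    bw u Qu = p₀ ++ u , ×ʳ-intro {P = P} {Q} p₀ u Pp₀ Qu , sym (map-lookup-++-↑ʳ p₀ u)

module _ {σ : Signature} where
  mutual
    VarsT-mono : ∀ {P Q : ℕ → Set} → (∀ {y} → P y → Q y) → (t : Term σ) → VarsT P t → VarsT Q t
    VarsT-mono P⊆Q (var y) p = P⊆Q p
    VarsT-mono P⊆Q (app F ts) p = VarsTs-mono P⊆Q ts p

    VarsTs-mono : ∀ {P Q : ℕ → Set} {k} → (∀ {y} → P y → Q y) → (ts : Vec (Term σ) k) → VarsTs P ts → VarsTs Q ts
    VarsTs-mono P⊆Q [] p = tt
    VarsTs-mono P⊆Q (t ∷ ts) (p , q) = VarsT-mono P⊆Q t p , VarsTs-mono P⊆Q ts q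

  VarsV-mono : ∀ {P Q : ℕ → Set} {k} → (∀ {y} → P y → Q y) → (xs : Vec ℕ k) → VarsV {σ} P xs → VarsV {σ} Q xs
  VarsV-mono P⊆Q [] p = tt
  VarsV-mono P⊆Q (x ∷ xs) (p , q) = P⊆Q p , VarsV-mono P⊆Q xs q

  FreeIn-mono : ∀ {P Q : ℕ → Set} → (∀ {y} → P y → Q y) → (φ : Formula σ) → FreeIn P φ → FreeIn Q φ
  FreeIn-mono P⊆Q (eqAt t t') (p , q) = VarsT-mono P⊆Q t p , VarsT-mono P⊆Q t' q
  FreeIn-mono P⊆Q (relAt R ts) p = VarsTs-mono P⊆Q ts p
  FreeIn-mono P⊆Q (incl xs ys) (p , q) = VarsV-mono P⊆Q xs p , VarsV-mono P⊆Q ys q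
  FreeIn-mono P⊆Q (dep xs) p = VarsV-mono P⊆Q xs p
  FreeIn-mono P⊆Q (neg φ) p = FreeIn-mono P⊆Q φ p
  FreeIn-mono P⊆Q (conj φ ψ) (p , q) = FreeIn-mono P⊆Q φ p , FreeIn-mono P⊆Q ψ q
  FreeIn-mono P⊆Q (disj φ ψ) (p , q) = FreeIn-mono P⊆Q φ p , FreeIn-mono P⊆Q ψ q
  FreeIn-mono P⊆Q (ex1 x φ) p = FreeIn-mono (Sum.map₂ P⊆Q) φ p
  FreeIn-mono P⊆Q (all1 x φ) p = FreeIn-mono (Sum.map₂ P⊆Q) φ p

  mutual
    VarsT-full : ∀ {P : ℕ → Set} → (∀ y → P y) → (t : Term σ) → VarsT P t
    VarsT-full all (var y) = all y
    VarsT-full all (app F ts) = VarsTs-full all ts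

    VarsTs-full : ∀ {P : ℕ → Set} {k} → (∀ y → P y) → (ts : Vec (Term σ) k) → VarsTs P ts
    VarsTs-full all [] = tt
    VarsTs-full all (t ∷ ts) = VarsT-full all t , VarsTs-full all ts

  VarsV-full : ∀ {P : ℕ → Set} {k} → (∀ y → P y) → (xs : Vec ℕ k) → VarsV {σ} P xs
  VarsV-full all [] = tt
  VarsV-full all (x ∷ xs) = all x , VarsV-full all xs

  FreeIn-full : ∀ {P : ℕ → Set} → (∀ y → P y) → (φ : Formula σ) → FreeIn P φ
  FreeIn-full all (eqAt t t') = VarsT-full all t , VarsT-full all t'
  FreeIn-full all (relAt R ts) = VarsTs-full all ts
  FreeIn-full all (incl xs ys) = VarsV-full all xs , VarsV-full all ys
  FreeIn-full all (dep xs) = VarsV-full all xs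
  FreeIn-full all (neg φ) = FreeIn-full all φ
  FreeIn-full all (conj φ ψ) = FreeIn-full all φ , FreeIn-full all ψ
  FreeIn-full all (disj φ ψ) = FreeIn-full all φ , FreeIn-full all ψ
  FreeIn-full all (ex1 x φ) = FreeIn-full (inj₂ ∘ all) φ
  FreeIn-full all (all1 x φ) = FreeIn-full (inj₂ ∘ all) φ

-- Semantics.lookupVar is parametrised by a structure it does not use; this
-- copy lets 𝔄 and 𝔅 share variable positions definitionally.
varIndex : ∀ {m} → Vec ℕ m → ℕ → Maybe (Fin m)
varIndex [] x = nothing
varIndex (y ∷ ys) x with x ≟ y
... | yes _ = just Fin.zero
... | no _ = Maybe.map Fin.suc (varIndex ys x)

lookupVar≡varIndex : ∀ {σ} (𝔐 : Structure σ) {m} (ns : Vec ℕ m) x → Semantics.lookupVar 𝔐 ns x ≡ varIndex ns x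
lookupVar≡varIndex 𝔐 [] x = refl
lookupVar≡varIndex 𝔐 (y ∷ ys) x with x ≟ y
... | yes _ = refl
... | no _ = cong (Maybe.map Fin.suc) (lookupVar≡varIndex 𝔐 ys x)

varIndex-sound : ∀ {m} (ns : Vec ℕ m) x i → varIndex ns x ≡ just i → lookup ns i ≡ x
varIndex-sound (y ∷ ys) x i e with x ≟ y
varIndex-sound (y ∷ ys) x i refl | yes x≡y = sym x≡y
... | no _ with varIndex ys x in e'
varIndex-sound (y ∷ ys) x .(Fin.suc j) refl | no _ | just j = varIndex-sound ys x j e'

varIndex-tabulate-suc : ∀ {K} (g : Fin K → ℕ) x → varIndex (tabulate (suc ∘ g)) (suc x) ≡ varIndex (tabulate g) x
varIndex-tabulate-suc {zero} g x = refl
varIndex-tabulate-suc {suc K} g x with suc x ≟ suc (g Fin.zero) | x ≟ g Fin.zero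
... | yes _ | yes _ = refl
... | no _  | no _  = cong (Maybe.map Fin.suc) (varIndex-tabulate-suc (g ∘ Fin.suc) x)
... | yes p | no ¬q = ⊥-elim (¬q (ℕ.suc-injective p))
... | no ¬p | yes q = ⊥-elim (¬p (cong suc q))

varIndex-tabulate : ∀ {K} (p : Fin K) → varIndex (tabulate toℕ) (toℕ p) ≡ just p
varIndex-tabulate Fin.zero = refl
varIndex-tabulate (Fin.suc p) = cong (Maybe.map Fin.suc) (trans (varIndex-tabulate-suc toℕ (toℕ p)) (varIndex-tabulate p))

InNames : ∀ {m} → Vec ℕ m → ℕ → Set
InNames ns y = Σ _ λ i → varIndex ns y ≡ just i

InNames-∷ : ∀ {m} (ns : Vec ℕ m) x {y} → y ≡ x ⊎ InNames ns y → InNames (x ∷ ns) y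
InNames-∷ ns x {y} h with y ≟ x
... | yes _ = Fin.zero , refl
InNames-∷ ns x (inj₁ e) | no y≢x = ⊥-elim (y≢x e)
InNames-∷ ns x (inj₂ (j , e)) | no _ = Fin.suc j , cong (Maybe.map Fin.suc) e

Below : ℕ → ℕ → Set
Below n y = Σ (Fin n) λ i → toℕ i ≡ y

Below⇒InNames : ∀ {n y} → Below n y → InNames (tabulate {n = n} toℕ) y
Below⇒InNames (i , refl) = i , varIndex-tabulate i

<⇒Below : ∀ {n y} → y < n → Below n y
<⇒Below y<n = Fin.fromℕ< y<n , Fin.toℕ-fromℕ< y<n

Below⇒< : ∀ {n y} → Below n y → y < n
Below⇒< (i , refl) = Fin.toℕ<n i

Below-suc : ∀ {n y} → Below (suc n) y → y ≡ n ⊎ Below n y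
Below-suc {n} {y} b with y ≟ n
... | yes y≡n = inj₁ y≡n
... | no y≢n = inj₂ (<⇒Below (ℕ.≤∧≢⇒< (ℕ.≤-pred (Below⇒< b)) y≢n))

freshBound : ∀ {m} (ns : Vec ℕ m) x → Σ ℕ λ N → x < N × (∀ {y} → InNames ns y → y < N)
freshBound ns x = suc (x + V.sum ns) , ℕ.s≤s (ℕ.m≤m+n x (V.sum ns)) , bound
  where
  lookup≤sum : ∀ {m} (ns : Vec ℕ m) j → lookup ns j ≤ V.sum ns
  lookup≤sum (y ∷ ys) Fin.zero = ℕ.m≤m+n y (V.sum ys)
  lookup≤sum (y ∷ ys) (Fin.suc j) = ℕ.≤-trans (lookup≤sum ys j) (ℕ.m≤n+m (V.sum ys) y)
  bound : ∀ {y} → InNames ns y → y < suc (x + V.sum ns)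
  bound {y} (j , e) = ℕ.s≤s (ℕ.≤-trans (subst (_≤ V.sum ns) (varIndex-sound ns y j e) (lookup≤sum ns j))
                                        (ℕ.m≤n+m (V.sum ns) x))

module Locality {σ : Signature} (𝔐 : Structure σ) where
  open Semantics 𝔐
  private
    C = Carrier 𝔐

  valueOf : ∀ {m} → Vec ℕ m → Vec C m → ℕ → Maybe C
  valueOf ns s y = Maybe.map (lookup s) (varIndex ns y)

  evalT-var : ∀ {m} (ns : Vec ℕ m) s y → evalT ns s (var y) ≡ valueOf ns s y
  evalT-var ns s y = cong (Maybe.map (lookup s)) (lookupVar≡varIndex 𝔐 ns y)

  consMaybe : ∀ {k} → Maybe C → Maybe (Vec C k) → Maybe (Vec C (suc k))
  consMaybe (just a) (just as) = just (a ∷ as)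
  consMaybe (just a) nothing = nothing
  consMaybe nothing _ = nothing

  consMaybe-inv : ∀ {k} (x : Maybe C) (y : Maybe (Vec C k)) {a w} →
                  consMaybe x y ≡ just (a ∷ w) → x ≡ just a × y ≡ just w
  consMaybe-inv (just a) (just w) refl = refl , refl

  evalTs-∷ : ∀ {m k} (ns : Vec ℕ m) s t (ts : Vec (Term σ) k) →
             evalTs ns s (t ∷ ts) ≡ consMaybe (evalT ns s t) (evalTs ns s ts)
  evalTs-∷ ns s t ts with evalT ns s t | evalTs ns s ts
  ... | just a  | just as = refl
  ... | just a  | nothing = refl
  ... | nothing | _       = refl

  Agree : ∀ {m m'} → (ℕ → Set) → Vec ℕ m → Vec C m → Vec ℕ m' → Vec C m' → Set
  Agree V ns s ns' s' = ∀ y → V y → valueOf ns s y ≡ valueOf ns' s' y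

  record _⊑[_]_ (T : Team) (V : ℕ → Set) (T' : Team) : Set where
    constructor mk⊑
    field
      match : ∀ s → Team.rel T s →
              Σ (Vec C _) λ s' → Team.rel T' s' × Agree V (Team.names T) s (Team.names T') s'
  open _⊑[_]_ public

  _≋[_]_ : Team → (ℕ → Set) → Team → Set
  T ≋[ V ] T' = T ⊑[ V ] T' × T' ⊑[ V ] T

  ⊑-trans : ∀ {V T T' T''} → T ⊑[ V ] T' → T' ⊑[ V ] T'' → T ⊑[ V ] T''
  ⊑-trans T⊑T' T'⊑T'' = mk⊑ λ s h →
    let s' , h' , ag = match T⊑T' s h
        s'' , h'' , ag' = match T'⊑T'' s' h'
    in s'' , h'' , λ y v → trans (ag y v) (ag' y v)

  ≋-sym : ∀ {V T T'} → T ≋[ V ] T' → T' ≋[ V ] T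
  ≋-sym (p , q) = q , p

  ≋-trans : ∀ {V T T' T''} → T ≋[ V ] T' → T' ≋[ V ] T'' → T ≋[ V ] T''
  ≋-trans (p , q) (p' , q') = ⊑-trans p p' , ⊑-trans q' q

  ≋-mono : ∀ {V W T T'} → (∀ {y} → W y → V y) → T ≋[ V ] T' → T ≋[ W ] T'
  ≋-mono W⊆V (p , q) = weaken p , weaken q
    where
    weaken : ∀ {T T'} → T ⊑[ _ ] T' → T ⊑[ _ ] T'
    weaken p = mk⊑ λ s h → let s' , h' , ag = match p s h in s' , h' , λ y → ag y ∘ W⊆V

  ≋-≐ : ∀ {V m} (ns : Vec ℕ m) {X Y} → X ≐ Y → team ns X ≋[ V ] team ns Y
  ≋-≐ ns (p , q) = mk⊑ (λ s h → s , p s h , λ _ _ → refl) , mk⊑ (λ s h → s , q s h , λ _ _ → refl)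

  ≋-empty : ∀ {V T T'} → IsEmpty (Team.rel T) → IsEmpty (Team.rel T') → T ≋[ V ] T'
  ≋-empty e e' = mk⊑ (λ s h → ⊥-elim (e s h)) , mk⊑ (λ s h → ⊥-elim (e' s h))

  mutual
    evalT-agree : ∀ {m m'} {ns : Vec ℕ m} {s} {ns' : Vec ℕ m'} {s'} V t →
                  VarsT V t → Agree V ns s ns' s' → evalT ns s t ≡ evalT ns' s' t
    evalT-agree {ns = ns} {s} {ns'} {s'} V (var y) p ag =
      trans (evalT-var ns s y) (trans (ag y p) (sym (evalT-var ns' s' y)))
    evalT-agree V (app F ts) p ag = cong (Maybe.map (funI 𝔐 F)) (evalTs-agree V ts p ag)

    evalTs-agree : ∀ {m m' k} {ns : Vec ℕ m} {s} {ns' : Vec ℕ m'} {s'} V (ts : Vec (Term σ) k) →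
                   VarsTs V ts → Agree V ns s ns' s' → evalTs ns s ts ≡ evalTs ns' s' ts
    evalTs-agree V [] p ag = refl
    evalTs-agree {ns = ns} {s} {ns'} {s'} V (t ∷ ts) (p , q) ag = begin
      evalTs ns s (t ∷ ts)                             ≡⟨ evalTs-∷ ns s t ts ⟩
      consMaybe (evalT ns s t) (evalTs ns s ts)        ≡⟨ cong₂ consMaybe (evalT-agree V t p ag) (evalTs-agree V ts q ag) ⟩
      consMaybe (evalT ns' s' t) (evalTs ns' s' ts)    ≡⟨ evalTs-∷ ns' s' t ts ⟨
      evalTs ns' s' (t ∷ ts)                           ∎
      where open ≡-Reasoning

  VarsV⇒VarsTs : ∀ {V : ℕ → Set} {k} (xs : Vec ℕ k) → VarsV {σ} V xs → VarsTs {σ} V (V.map var xs)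
  VarsV⇒VarsTs [] p = tt
  VarsV⇒VarsTs (x ∷ xs) (p , q) = p , VarsV⇒VarsTs xs q

  proj-⊑ : ∀ {V T T' k} (xs : Vec ℕ k) → VarsV {σ} V xs → T ⊑[ V ] T' → proj T xs ⊆ proj T' xs
  proj-⊑ {V} xs vs T⊑T' u (s , h , e) =
    let s' , h' , ag = match T⊑T' s h
    in s' , h' , trans (sym (evalTs-agree V (V.map var xs) (VarsV⇒VarsTs xs vs) ag)) e

  updateAt : ∀ {m} → Maybe (Fin m) → Vec ℕ m → Rel C m → ℕ → C → Team
  updateAt (just i) ns X x a = team ns (λ t → Σ (Vec C _) λ s → X s × t ≡ s [ i ]≔ a)
  updateAt nothing ns X x a = team (x ∷ ns) (λ t → X (V.tail t) × V.head t ≡ a)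

  update≡updateAt : ∀ {m} (ns : Vec ℕ m) X x a → update (team ns X) x a ≡ updateAt (varIndex ns x) ns X x a
  update≡updateAt ns X x a rewrite sym (lookupVar≡varIndex 𝔐 ns x) with lookupVar ns x
  ... | just i = refl
  ... | nothing = refl

  -- ns' is ns, or x ∷ ns when x is not among ns.
  record IsUpdate {m m'} (ns' : Vec ℕ m') (s' : Vec C m') (ns : Vec ℕ m) (s : Vec C m) (x : ℕ) (a : C) : Set where
    constructor isUpdate
    field
      updated   : valueOf ns' s' x ≡ just a
      unchanged : ∀ y → ¬ y ≡ x → valueOf ns' s' y ≡ valueOf ns s y
  open IsUpdate

  IsUpdate-[]≔ : ∀ {m} (ns : Vec ℕ m) x i (s : Vec C m) a → varIndex ns x ≡ just i → IsUpdate ns (s [ i ]≔ a) ns s x a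
  IsUpdate-[]≔ ns x i s a e = isUpdate at-x off-x
    where
    at-x : valueOf ns (s [ i ]≔ a) x ≡ just a
    at-x rewrite e = cong just (V.lookup∘update i s a)
    off-x : ∀ y → ¬ y ≡ x → valueOf ns (s [ i ]≔ a) y ≡ valueOf ns s y
    off-x y y≢x with varIndex ns y in e'
    ... | nothing = refl
    ... | just j = cong just (V.lookup∘update′ j≢i s a)
      where
      j≢i : ¬ j ≡ i
      j≢i j≡i = y≢x (trans (sym (varIndex-sound ns y j e')) (trans (cong (lookup ns) j≡i) (varIndex-sound ns x i e)))

  IsUpdate-∷ : ∀ {m} (ns : Vec ℕ m) x (s : Vec C m) a → IsUpdate (x ∷ ns) (a ∷ s) ns s x a
  IsUpdate-∷ ns x s a = isUpdate at-x off-x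
    where
    at-x : valueOf (x ∷ ns) (a ∷ s) x ≡ just a
    at-x with x ≟ x
    ... | yes _ = refl
    ... | no x≢x = ⊥-elim (x≢x refl)
    off-x : ∀ y → ¬ y ≡ x → valueOf (x ∷ ns) (a ∷ s) y ≡ valueOf ns s y
    off-x y y≢x with y ≟ x
    ... | yes y≡x = ⊥-elim (y≢x y≡x)
    ... | no _ = sym (map-∘ (varIndex ns y))

  update-elim : ∀ T x a s' → Team.rel (update T x a) s' →
                Σ (Vec C _) λ s → Team.rel T s × IsUpdate (Team.names (update T x a)) s' (Team.names T) s x a
  update-elim (team ns X) x a rewrite update≡updateAt ns X x a = go (varIndex ns x) refl
    where
    go : ∀ r → varIndex ns x ≡ r → ∀ s' → Team.rel (updateAt r ns X x a) s' →
         Σ (Vec C _) λ s → X s × IsUpdate (Team.names (updateAt r ns X x a)) s' ns s x a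
    go (just i) e s' (s , Xs , refl) = s , Xs , IsUpdate-[]≔ ns x i s a e
    go nothing e (c ∷ s) (Xs , refl) = s , Xs , IsUpdate-∷ ns x s a

  update-intro : ∀ T x a s → Team.rel T s →
                 Σ (Vec C _) λ s' → Team.rel (update T x a) s' × IsUpdate (Team.names (update T x a)) s' (Team.names T) s x a
  update-intro (team ns X) x a rewrite update≡updateAt ns X x a = go (varIndex ns x) refl
    where
    go : ∀ r → varIndex ns x ≡ r → ∀ s → X s →
         Σ (Vec C _) λ s' → Team.rel (updateAt r ns X x a) s' × IsUpdate (Team.names (updateAt r ns X x a)) s' ns s x a
    go (just i) e s Xs = s [ i ]≔ a , (s , Xs , refl) , IsUpdate-[]≔ ns x i s a e
    go nothing e s Xs = a ∷ s , (Xs , refl) , IsUpdate-∷ ns x s a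

  IsUpdate-agree : ∀ {V : ℕ → Set} {m₁ m₁' m m'} {ns₁ : Vec ℕ m₁} {s₁} {ns₁' : Vec ℕ m₁'} {s₁'}
                   {ns : Vec ℕ m} {s} {ns' : Vec ℕ m'} {s'} {x a} →
                   IsUpdate ns₁ s₁ ns s x a → IsUpdate ns₁' s₁' ns' s' x a → Agree V ns s ns' s' →
                   Agree (λ y → y ≡ x ⊎ V y) ns₁ s₁ ns₁' s₁'
  IsUpdate-agree {x = x} (isUpdate at-x off-x) (isUpdate at-x' off-x') ag y y∈ with y ≟ x
  ... | yes refl = trans at-x (sym at-x')
  ... | no y≢x = trans (off-x y y≢x) (trans (ag y (Sum.[ (λ y≡x → ⊥-elim (y≢x y≡x)) , id ] y∈)) (sym (off-x' y y≢x)))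

  update-⊑ : ∀ {V T T'} x a → T ⊑[ V ] T' → update T x a ⊑[ (λ y → y ≡ x ⊎ V y) ] update T' x a
  update-⊑ {T = T} {T'} x a T⊑T' = mk⊑ λ s₁ h₁ →
    let s , h , upd = update-elim T x a s₁ h₁
        s' , h' , ag = match T⊑T' s h
        s₁' , h₁' , upd' = update-intro T' x a s' h'
    in s₁' , h₁' , IsUpdate-agree upd upd' ag

  update-≋ : ∀ {V T T'} x a → T ≋[ V ] T' → update T x a ≋[ (λ y → y ≡ x ⊎ V y) ] update T' x a
  update-≋ x a (p , q) = update-⊑ x a p , update-⊑ x a q

  ≋-update : ∀ T x a → T ≋[ (λ y → ¬ y ≡ x) ] update T x a
  ≋-update T x a = mk⊑ (λ s h → let s' , h' , upd = update-intro T x a s h in s' , h' , λ y → sym ∘ unchanged upd y)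
                 , mk⊑ (λ s' h' → let s , h , upd = update-elim T x a s' h' in s , h , unchanged upd)

  IsEmpty-update : ∀ T x a → IsEmpty (Team.rel T) → IsEmpty (Team.rel (update T x a))
  IsEmpty-update T x a empty s h = let s₀ , h₀ , _ = update-elim T x a s h in empty s₀ h₀

  IsEmpty-update⁻¹ : ∀ T x a → IsEmpty (Team.rel (update T x a)) → IsEmpty (Team.rel T)
  IsEmpty-update⁻¹ T x a empty s h = let s' , h' , _ = update-intro T x a s h in empty s' h'

  locality : ∀ φ {V T T'} → FreeIn V φ → T ≋[ V ] T' → Sat T φ → Sat T' φ
  locality (eqAt t t') {V} (pt , pt') (_ , T'⊑T) sat s' h' =
    let s , h , ag = match T'⊑T s' h'
    in subst₂ holdsEq (sym (evalT-agree V t pt ag)) (sym (evalT-agree V t' pt' ag)) (sat s h)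
  locality (relAt R ts) {V} pts (_ , T'⊑T) sat s' h' =
    let s , h , ag = match T'⊑T s' h'
    in subst (holdsRel (relI 𝔐 R)) (sym (evalTs-agree V ts pts ag)) (sat s h)
  locality (incl xs ys) (px , py) (T⊑T' , T'⊑T) sat u =
    proj-⊑ ys py T⊑T' u ∘ sat u ∘ proj-⊑ xs px T'⊑T u
  locality (dep xs) px (_ , T'⊑T) sat u u' h h' = sat u u' (proj-⊑ xs px T'⊑T u h) (proj-⊑ xs px T'⊑T u' h')
  locality (neg φ) fv (_ , T'⊑T) (inj₁ empty) = inj₁ λ s' h' → empty _ (proj₁ (proj₂ (match T'⊑T s' h')))
  locality (neg φ) fv (p , q) (inj₂ ¬sat) = inj₂ (¬sat ∘ locality φ fv (q , p))
  locality (conj φ ψ) (fφ , fψ) eqv (a , b) = locality φ fφ eqv a , locality ψ fψ eqv b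
  locality (disj φ ψ) (fφ , fψ) eqv = Sum.map (locality φ fφ eqv) (locality ψ fψ eqv)
  locality (ex1 x φ) fv eqv (a , h) = a , locality φ fv (update-≋ x a eqv) h
  locality (all1 x φ) fv eqv h a = locality φ fv (update-≋ x a eqv) (h a)

  Sat-resp-≐ : ∀ {m} (ns : Vec ℕ m) {Y Y' : Rel C m} φ → Y ≐ Y' → Sat (team ns Y) φ → Sat (team ns Y') φ
  Sat-resp-≐ ns φ e = locality φ {λ _ → ⊤} (FreeIn-full _ φ) (≋-≐ ns e)

  Sat-cong-≐ : ∀ {m} (ns : Vec ℕ m) {Y Y' : Rel C m} φ → Y ≐ Y' → Sat (team ns Y) φ ⇔ Sat (team ns Y') φ
  Sat-cong-≐ ns φ e = mk⇔ (Sat-resp-≐ ns φ e) (Sat-resp-≐ ns φ (≐-sym e))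

module Canonical {σ : Signature} (𝔐 : Structure σ) where
  open Semantics 𝔐
  open Locality 𝔐
  private
    C = Carrier 𝔐

  teamOf : ∀ {n} → Rel C n → Team
  teamOf {n} W = team (tabulate {n = n} toℕ) W

  valueOf-tabulate : ∀ {K} (s : Vec C K) (p : Fin K) {y} → toℕ p ≡ y → valueOf (tabulate toℕ) s y ≡ just (lookup s p)
  valueOf-tabulate s p refl = cong (Maybe.map (lookup s)) (varIndex-tabulate p)

  valueOf-↑ˡ : ∀ {N} (t : Vec C N) r {y} → y < N → valueOf (tabulate toℕ) (t ++ (r ∷ [])) y ≡ valueOf (tabulate toℕ) t y
  valueOf-↑ˡ {N} t r y<N = begin
    valueOf (tabulate toℕ) (t ++ (r ∷ [])) _ ≡⟨ valueOf-tabulate (t ++ (r ∷ [])) (i ↑ˡ 1)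
                                                  (trans (Fin.toℕ-↑ˡ i 1) (Fin.toℕ-fromℕ< y<N)) ⟩
    just (lookup (t ++ (r ∷ [])) (i ↑ˡ 1))  ≡⟨ cong just (V.lookup-++ˡ t (r ∷ []) i) ⟩
    just (lookup t i)                       ≡⟨ valueOf-tabulate t i (Fin.toℕ-fromℕ< y<N) ⟨
    valueOf (tabulate toℕ) t _              ∎
    where
    open ≡-Reasoning
    i = Fin.fromℕ< y<N

  valueOf-last : ∀ {N} (t : Vec C N) r → valueOf (tabulate toℕ) (t ++ (r ∷ [])) N ≡ just r
  valueOf-last {N} t r =
    trans (valueOf-tabulate (t ++ (r ∷ [])) (N ↑ʳ Fin.zero) (trans (Fin.toℕ-↑ʳ N Fin.zero) (ℕ.+-identityʳ N)))
          (cong just (V.lookup-++ʳ t (r ∷ []) Fin.zero))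

  ×ʳ-sing-≋ : ∀ {N} (Z : Rel C N) r → teamOf (Z ×ʳ sing r) ≋[ Below N ] teamOf Z
  ×ʳ-sing-≋ {N} Z r = mk⊑ drop-r , mk⊑ add-r
    where
    drop-r : ∀ v → (Z ×ʳ sing r) v → _
    drop-r v h with V.splitAt N v
    ... | t , r' , refl with h
    ... | Zt , refl = t , Zt , λ y b → valueOf-↑ˡ t r (Below⇒< b)
    add-r : ∀ t → Z t → _
    add-r t Zt = t ++ (r ∷ []) , ×ʳ-intro {P = Z} {Q = sing r} t (r ∷ []) Zt refl , λ y b → sym (valueOf-↑ˡ t r (Below⇒< b))

  valueOf-×ʳ-sing : ∀ {N} (Z : Rel C N) r v → (Z ×ʳ sing r) v → valueOf (tabulate toℕ) v N ≡ just r
  valueOf-×ʳ-sing {N} Z r v h with V.splitAt N v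
  ... | t , r' , refl with h
  ... | _ , refl = valueOf-last t r

  update-≋-×ʳ-sing : ∀ {n} (X : Rel C n) a → update (teamOf X) n a ≋[ Below (suc n) ] teamOf (X ×ʳ sing a)
  update-≋-×ʳ-sing {n} X a = mk⊑ forth , mk⊑ back
    where
    agree : ∀ {s' s} → IsUpdate (Team.names (update (teamOf X) n a)) s' (tabulate toℕ) s n a →
            Agree (Below (suc n)) (Team.names (update (teamOf X) n a)) s' (tabulate toℕ) (s ++ (a ∷ []))
    agree {s = s} (isUpdate updated unchanged) y b with Below-suc b
    ... | inj₁ refl = trans updated (sym (valueOf-last s a))
    ... | inj₂ b' = trans (unchanged y (λ { refl → ℕ.<-irrefl refl (Below⇒< b') })) (sym (valueOf-↑ˡ s a (Below⇒< b')))
    forth : ∀ s' → Team.rel (update (teamOf X) n a) s' → _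
    forth s' h' with update-elim (teamOf X) n a s' h'
    ... | s , h , upd = s ++ (a ∷ []) , ×ʳ-intro {P = X} {Q = sing a} s (a ∷ []) h refl , agree upd
    back : ∀ v → (X ×ʳ sing a) v → _
    back v h with V.splitAt n v
    ... | s , a' , refl with h
    ... | Xs , refl with update-intro (teamOf X) n a s Xs
    ... | s' , h' , upd = s' , h' , λ y b → sym (agree upd y b)

  vars : ∀ {p k} → Vec (Fin p) k → Vec (Term σ) k
  vars ı = V.map var (V.map toℕ ı)

  evalVars-tabulate : ∀ {p k} (s : Vec C p) (ı : Vec (Fin p) k) → evalTs (tabulate toℕ) s (vars ı) ≡ just (V.map (lookup s) ı)
  evalVars-tabulate s [] = refl
  evalVars-tabulate s (i ∷ ı) =
    trans (evalTs-∷ (tabulate toℕ) s (var (toℕ i)) (vars ı))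
          (cong₂ consMaybe (trans (evalT-var (tabulate toℕ) s (toℕ i)) (valueOf-tabulate s i refl)) (evalVars-tabulate s ı))

  proj-tabulate : ∀ {p k} (W : Rel C p) (ı : Vec (Fin p) k) → proj (teamOf W) (V.map toℕ ı) ≐ Pr ı W
  proj-tabulate W ı = (λ u (s , h , e) → s , h , sym (just-injective (trans (sym (evalVars-tabulate s ı)) e)))
                    , (λ u (s , h , e) → s , h , trans (evalVars-tabulate s ı) (cong just (sym e)))

  inclFormula : ∀ {p k} → Vec (Fin p) k → Vec (Fin p) k → Formula σ
  inclFormula ı ȷ = incl (V.map toℕ ı) (V.map toℕ ȷ)

  sat-inclFormula : ∀ {p k} (ı ȷ : Vec (Fin p) k) (W : Rel C p) → Sat (teamOf W) (inclFormula ı ȷ) ⇔ (Pr ı W ⊆ Pr ȷ W)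
  sat-inclFormula ı ȷ W = ⊆-cong-≐ (proj-tabulate W ı) (proj-tabulate W ȷ)

  depFormula : ∀ n → Formula σ
  depFormula n = dep (V.map toℕ (allFin n))

  sat-depFormula : ∀ {n} (W : Rel C n) → Sat (teamOf W) (depFormula n) ⇔ IsSubsingleton W
  sat-depFormula W = IsSubsingleton-cong-≐ (≐-trans (proj-tabulate W _) (Pr-allFin W))

  -- The empty inclusion atom holds in every team, so its negation only in the empty one.
  emptyFormula : Formula σ
  emptyFormula = neg (incl {k = 0} [] [])

  sat-emptyFormula : ∀ {p} (W : Rel C p) → Sat (teamOf W) emptyFormula ⇔ IsEmpty W
  sat-emptyFormula W = mk⇔ (λ { (inj₁ e) → e ; (inj₂ ¬sat) → ⊥-elim (¬sat (λ _ h → h)) }) inj₁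

  diagFormula : Formula σ
  diagFormula = eqAt (var 0) (var 1)

  sat-diagFormula : ∀ (W : Rel C 2) → Sat (teamOf W) diagFormula ⇔ (W ⊆ Diag)
  sat-diagFormula W = mk⇔ id id

  relFormula : (R : RelSym σ) → Formula σ
  relFormula R = relAt R (vars (allFin (rarity σ R)))

  sat-relFormula : ∀ R (W : Rel C (rarity σ R)) → Sat (teamOf W) (relFormula R) ⇔ (W ⊆ relI 𝔐 R)
  sat-relFormula R W = mk⇔ (λ h s → subst (holdsRel (relI 𝔐 R)) (eval-args s) ∘ h s)
                           (λ h s → subst (holdsRel (relI 𝔐 R)) (sym (eval-args s)) ∘ h s)
    where
    eval-args : ∀ s → evalTs (tabulate toℕ) s (vars (allFin (rarity σ R))) ≡ just s
    eval-args s = trans (evalVars-tabulate s _) (cong just (map-lookup-allFin s))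

  graphFormula : (F : FunSym σ) → Formula σ
  graphFormula F = eqAt (app F (vars (tabulate Fin.inject₁))) (var (toℕ (Fin.fromℕ (farity σ F))))

  sat-graphFormula : ∀ F (W : Rel C (suc (farity σ F))) → Sat (teamOf W) (graphFormula F) ⇔ (W ⊆ Graph (funI 𝔐 F))
  sat-graphFormula F W = mk⇔ (λ h s → subst₂ holdsEq (eval-app s) (eval-last s) ∘ h s)
                             (λ h s → subst₂ holdsEq (sym (eval-app s)) (sym (eval-last s)) ∘ h s)
    where
    k = farity σ F
    eval-app : ∀ s → evalT (tabulate toℕ) s (app F (vars (tabulate Fin.inject₁))) ≡ just (funI 𝔐 F (V.init s))
    eval-app s = cong (Maybe.map (funI 𝔐 F)) (trans (evalVars-tabulate s (tabulate Fin.inject₁))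
                                                    (cong just (V.∷-injectiveʳ (map-lookup-lastFirst s))))
    eval-last : ∀ s → evalT (tabulate toℕ) s (var (toℕ (Fin.fromℕ k))) ≡ just (V.last s)
    eval-last s = trans (evalT-var (tabulate toℕ) s (toℕ (Fin.fromℕ k)))
                        (trans (valueOf-tabulate s (Fin.fromℕ k) refl) (cong just (V.∷-injectiveˡ (map-lookup-lastFirst s))))

VarsV-tabulate : ∀ {σ} {p k} (ı : Vec (Fin p) k) → VarsV {σ} (Below p) (V.map toℕ ı)
VarsV-tabulate [] = tt
VarsV-tabulate {σ} (i ∷ ı) = (i , refl) , VarsV-tabulate {σ} ı

module FromElementary (em : ExcludedMiddle 0ℓ) {σ : Signature} {𝔄 𝔅 : Structure σ} (f : TeamMap 𝔄 𝔅)
                      (elementary : IsElementaryTeamEmbedding f) where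
  open IsElementaryTeamEmbedding elementary
  private
    A = Carrier 𝔄
    B = Carrier 𝔅
    fm : ∀ {n} → Rel A n → Rel B n
    fm = fmap f
    module LA = Locality 𝔄
    module LB = Locality 𝔅
    module CA = Canonical 𝔄
    module CB = Canonical 𝔅

  empty⇔ : ∀ {n} (X : Rel A n) → IsEmpty X ⇔ IsEmpty (fm X)
  empty⇔ {n} X = ⇔.trans (⇔.sym (CA.sat-emptyFormula X))
                         (⇔.trans (el-sat n CA.emptyFormula (tt , tt) X) (CB.sat-emptyFormula (fm X)))

  nonEmpty⇔ : ∀ {n} (X : Rel A n) → NonEmpty X ⇔ NonEmpty (fm X)
  nonEmpty⇔ X = mk⇔ (nonEmpty-from (from (empty⇔ X))) (nonEmpty-from (to (empty⇔ X)))
    where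
    nonEmpty-from : ∀ {C D : Set} {n} {P : Rel C n} {Q : Rel D n} → (IsEmpty Q → IsEmpty P) → NonEmpty P → NonEmpty Q
    nonEmpty-from {Q = Q} empty (v , h) with em {NonEmpty Q}
    ... | yes ne = ne
    ... | no ¬ne = ⊥-elim (empty (λ w h' → ¬ne (w , h')) v h)

  Pr⊆Pr⇔ : ∀ {p k} (ı ȷ : Vec (Fin p) k) (W : Rel A p) → Pr ı W ⊆ Pr ȷ W ⇔ Pr ı (fm W) ⊆ Pr ȷ (fm W)
  Pr⊆Pr⇔ {p} ı ȷ W = ⇔.trans (⇔.sym (CA.sat-inclFormula ı ȷ W))
                             (⇔.trans (el-sat p (CA.inclFormula ı ȷ) (VarsV-tabulate {σ} ı , VarsV-tabulate {σ} ȷ) W)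
                                      (CB.sat-inclFormula ı ȷ (fm W)))

  ×ʳ-Pr⊆Pr⇔ : ∀ {n k j} (ı ȷ : Vec (Fin (n + k)) j) (X : Rel A n) (Y : Rel A k) →
              Pr ı (X ×ʳ Y) ⊆ Pr ȷ (X ×ʳ Y) ⇔ Pr ı (fm X ×ʳ fm Y) ⊆ Pr ȷ (fm X ×ʳ fm Y)
  ×ʳ-Pr⊆Pr⇔ ı ȷ X Y = ⇔.trans (Pr⊆Pr⇔ ı ȷ (X ×ʳ Y))
                               (⊆-cong-≐ (Pr-resp-≐ ı (el-× X Y)) (Pr-resp-≐ ȷ (el-× X Y)))

  Pr⊆⇔ : ∀ {n k} (ı : Vec (Fin n) k) {X : Rel A n} {Y : Rel A k} → NonEmpty X → NonEmpty Y →
         Pr ı X ⊆ Y ⇔ Pr ı (fm X) ⊆ fm Y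
  Pr⊆⇔ ı {X} {Y} neX neY = ⇔.trans (⊆-cong-≐ (≐-sym (Pr-↑ˡ-×ʳ X Y ı neY)) (≐-sym (Pr-↑ʳ-×ʳ X Y neX)))
    (⇔.trans (×ʳ-Pr⊆Pr⇔ _ _ X Y)
             (⊆-cong-≐ (Pr-↑ˡ-×ʳ (fm X) (fm Y) ı (to (nonEmpty⇔ Y) neY))
                       (Pr-↑ʳ-×ʳ (fm X) (fm Y) (to (nonEmpty⇔ X) neX))))

  ⊆Pr⇔ : ∀ {n k} (ı : Vec (Fin n) k) {X : Rel A n} {Y : Rel A k} → NonEmpty X → NonEmpty Y →
         Y ⊆ Pr ı X ⇔ fm Y ⊆ Pr ı (fm X)
  ⊆Pr⇔ ı {X} {Y} neX neY = ⇔.trans (⊆-cong-≐ (≐-sym (Pr-↑ʳ-×ʳ X Y neX)) (≐-sym (Pr-↑ˡ-×ʳ X Y ı neY)))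
    (⇔.trans (×ʳ-Pr⊆Pr⇔ _ _ X Y)
             (⊆-cong-≐ (Pr-↑ʳ-×ʳ (fm X) (fm Y) (to (nonEmpty⇔ X) neX))
                       (Pr-↑ˡ-×ʳ (fm X) (fm Y) ı (to (nonEmpty⇔ Y) neY))))

  ⊆⇔ : ∀ {n} (X Y : Rel A n) → X ⊆ Y ⇔ fm X ⊆ fm Y
  ⊆⇔ {n} X Y with em {NonEmpty X}
  ... | no ¬neX = mk⇔ (λ _ v h → ⊥-elim (to (empty⇔ X) (λ w h' → ¬neX (w , h')) v h)) (λ _ v h → ⊥-elim (¬neX (v , h)))
  ... | yes neX@(v , h) = mk⇔ (λ X⊆Y → to (given (v , X⊆Y v h)) X⊆Y)
                              (λ fX⊆fY → let w , h' = to (nonEmpty⇔ X) neX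
                                         in from (given (from (nonEmpty⇔ Y) (w , fX⊆fY w h'))) fX⊆fY)
    where
    given : NonEmpty Y → X ⊆ Y ⇔ fm X ⊆ fm Y
    given neY = ⇔.trans (⊆-cong-≐ (≐-sym (Pr-allFin X)) ≐-refl)
                        (⇔.trans (Pr⊆⇔ (allFin n) neX neY) (⊆-cong-≐ (Pr-allFin (fm X)) ≐-refl))

  full⇔ : ∀ {n} (X : Rel A n) → IsFull X ⇔ IsFull (fm X)
  full⇔ {n} X with Closed.cl-full (rangeClosed f) n
  ... | Z , fZ≐Full = ⇔.trans (full⇔⊆ Z-full) (⇔.trans (⊆⇔ Z X) (⇔.sym (full⇔⊆ (λ v → proj₂ fZ≐Full v tt))))
    where
    full⇔⊆ : ∀ {C : Set} {F W : Rel C n} → IsFull F → IsFull W ⇔ F ⊆ W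
    full⇔⊆ F-full = mk⇔ (λ W-full v _ → W-full v) (λ F⊆W v → F⊆W v (F-full v))
    Z-full : IsFull Z
    Z-full v = from (⊆⇔ (Full n) Z) (λ w _ → proj₂ fZ≐Full w tt) v tt

  subsingleton⇔ : ∀ {n} (X : Rel A n) → IsSubsingleton X ⇔ IsSubsingleton (fm X)
  subsingleton⇔ {n} X = ⇔.trans (⇔.sym (CA.sat-depFormula X))
                                (⇔.trans (el-sat n (CA.depFormula n) (VarsV-tabulate {σ} (allFin n)) X) (CB.sat-depFormula (fm X)))

  singleton⇔ : ∀ {n} (X : Rel A n) → IsSingleton X ⇔ IsSingleton (fm X)
  singleton⇔ X = ⇔.trans (singleton⇔¬empty×subsingleton em X)
                         (⇔.trans (¬-cong-⇔ (empty⇔ X) ×-⇔ subsingleton⇔ X)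
                                  (⇔.sym (singleton⇔¬empty×subsingleton em (fm X))))

  Pr-commutes : ∀ {n k} (ı : Vec (Fin n) k) (X : Rel A n) → fm (Pr ı X) ≐ Pr ı (fm X)
  Pr-commutes ı X with em {NonEmpty X}
  ... | no ¬neX = (λ u h → ⊥-elim (to (empty⇔ (Pr ı X)) (λ u (v , h' , _) → ¬neX (v , h')) u h))
                , (λ u (v , h , _) → ⊥-elim (to (empty⇔ X) (λ w h' → ¬neX (w , h')) v h))
  ... | yes neX@(v , h) = to (⊆Pr⇔ ı neX nePr) (λ _ → id) , to (Pr⊆⇔ ı neX nePr) (λ _ → id)
    where
    nePr : NonEmpty (Pr ı X)
    nePr = V.map (lookup v) ı , v , h , refl

  fmap-definable : ∀ {k} (P : Rel A k) (Q : Rel B k) (χ : Formula σ) → FreeBelow k χ →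
                   (∀ W → 𝔄 ⊨[ W ] χ ⇔ (W ⊆ P)) → (∀ W → 𝔅 ⊨[ W ] χ ⇔ (W ⊆ Q)) → InRange f Q → fm P ≐ Q
  fmap-definable {k} P Q χ fv defA defB (Z , fZ≐Q) = fP⊆Q , λ v → to (⊆⇔ Z P) Z⊆P v ∘ proj₂ fZ≐Q v
    where
    fP⊆Q : fm P ⊆ Q
    fP⊆Q = to (defB (fm P)) (to (el-sat k χ fv P) (from (defA P) (λ _ → id)))
    Z⊆P : Z ⊆ P
    Z⊆P = to (defA Z) (from (el-sat k χ fv Z) (from (defB (fm Z)) (proj₁ fZ≐Q)))

  isTeamEmbedding : IsTeamEmbedding f
  isTeamEmbedding = record
    { emb-empty = empty⇔
    ; emb-full  = full⇔
    ; emb-sing  = singleton⇔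
    ; emb-incl  = ⊆⇔
    ; emb-×     = el-×
    ; emb-Pr    = Pr-commutes
    ; emb-diag  = fmap-definable Diag Diag CA.diagFormula ((Fin.zero , refl) , (Fin.suc Fin.zero , refl))
                                 CA.sat-diagFormula CB.sat-diagFormula (Closed.cl-diag range)
    ; emb-rel   = λ R → fmap-definable (relI 𝔄 R) (relI 𝔅 R) (CA.relFormula R)
                                       (LA.VarsV⇒VarsTs _ (VarsV-tabulate {σ} (allFin _)))
                                       (CA.sat-relFormula R) (CB.sat-relFormula R) (Closed.cl-rel range R)
    ; emb-fun   = λ F → fmap-definable (Graph (funI 𝔄 F)) (Graph (funI 𝔅 F)) (CA.graphFormula F)
                                       (LA.VarsV⇒VarsTs _ (VarsV-tabulate {σ} (tabulate Fin.inject₁)) , (Fin.fromℕ _ , refl))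
                                       (CA.sat-graphFormula F) (CB.sat-graphFormula F) (Closed.cl-fun range F)
    }
    where
    range = rangeClosed f

  tarskiVaught : TarskiVaught f
  tarskiVaught n φ fv X sat with from (el-sat n (ex1 n φ) (FreeIn-mono Below-suc φ fv) X) sat
  ... | a , Xa⊨φ with to (singleton⇔ (sing a)) ((a ∷ []) , λ _ → id , id)
  ... | (b ∷ []) , fa≐b = a , b , fa≐b , LB.Sat-resp-≐ (tabulate toℕ) φ fXa≐fX×b fXa⊨φ
    where
    fXa≐fX×b : fm (X ×ʳ sing a) ≐ (fm X ×ʳ sing b)
    fXa≐fX×b = ≐-trans (el-× X (sing a)) (×ʳ-resp-≐ (≐-refl {X = fm X}) (IsSingletonOf⇒≐sing fa≐b))
    Below-+1 : ∀ {y} → Below (suc n) y → Below (n + 1) y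
    Below-+1 {y} b = <⇒Below (subst (y <_) (ℕ.+-comm 1 n) (Below⇒< b))
    fXa⊨φ : 𝔅 ⊨[ fm (X ×ʳ sing a) ] φ
    fXa⊨φ = to (el-sat (n + 1) φ (FreeIn-mono Below-+1 φ fv) (X ×ʳ sing a))
               (LA.locality φ fv (CA.update-≋-×ʳ-sing X a) Xa⊨φ)

-- Tarski–Vaught only provides witnesses for a fresh last variable vₙ; the
-- padded formula moves the witness of x there.
module Padding {σ : Signature} (𝔐 : Structure σ) where
  open Semantics 𝔐
  open Locality 𝔐

  padded : ℕ → ℕ → Formula σ → Formula σ
  padded N x φ = ex1 x (conj (eqAt (var x) (var N)) φ)

  pad : ∀ {V : ℕ → Set} T (x N : ℕ) φ → ¬ N ≡ x → (∀ {y} → V y → ¬ y ≡ N) → FreeIn (λ y → y ≡ x ⊎ V y) φ →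
        Sat T (ex1 x φ) → Sat T (ex1 N (padded N x φ))
  pad {V} T x N φ N≢x N∉V fv (b , φ-holds) =
    b , b , x=N , locality φ fv (≋-mono {W = λ y → y ≡ x ⊎ V y} (Sum.map₂ N∉V) T≋T₂) φ-holds
    where
    T₂ : Team
    T₂ = update (update T N b) x b
    T≋T₂ : update T x b ≋[ (λ y → y ≡ x ⊎ ¬ y ≡ N) ] T₂
    T≋T₂ = update-≋ x b (≋-update T N b)
    x=N : Sat T₂ (eqAt (var x) (var N))
    x=N s h =
      let s₁ , h₁ , upd = update-elim (update T N b) x b s h
          _ , _ , upd₁ = update-elim T N b s₁ h₁
      in subst₂ holdsEq (sym (trans (evalT-var (Team.names T₂) s x) (IsUpdate.updated upd)))
                        (sym (trans (evalT-var (Team.names T₂) s N) (trans (IsUpdate.unchanged upd N N≢x) (IsUpdate.updated upd₁))))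
                        refl

  unpad : ∀ {V : ℕ → Set} U T (x N : ℕ) c b φ → ¬ N ≡ x → U ≋[ V ] T →
          (∀ s → Team.rel U s → valueOf (Team.names U) s N ≡ just b) → FreeIn (λ y → y ≡ x ⊎ V y) φ →
          Sat (update U x c) (conj (eqAt (var x) (var N)) φ) → Sat (update T x b) φ
  unpad U T x N c b φ N≢x (U⊑T , T⊑U) N↦b fv (x=N , φ-holds) = locality φ fv (mk⊑ forth , mk⊑ back) φ-holds
    where
    c≡b : ∀ s → Team.rel (update U x c) s → c ≡ b
    c≡b s h =
      let s₀ , h₀ , upd = update-elim U x c s h
      in subst₂ holdsEq (trans (evalT-var (Team.names (update U x c)) s x) (IsUpdate.updated upd))
                        (trans (evalT-var (Team.names (update U x c)) s N) (trans (IsUpdate.unchanged upd N N≢x) (N↦b s₀ h₀)))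
                        (x=N s h)
    forth : ∀ s → Team.rel (update U x c) s → _
    forth s h = match (subst (λ z → update U x c ⊑[ _ ] update T x z) (c≡b s h) (update-⊑ x c U⊑T)) s h
    back : ∀ s → Team.rel (update T x b) s → _
    back s h =
      let t , ht , _ = update-elim T x b s h
          u , hu , _ = match T⊑U t ht
          u' , hu' , _ = update-intro U x c u hu
      in match (subst (λ z → update T x z ⊑[ _ ] update U x c) (c≡b u' hu') (update-⊑ x c T⊑U)) s h

-- Expressions are interpreted in 𝔄 with the parameters as they are and in 𝔅
-- with their f-images; a team embedding commutes with this interpretation.
module RelExpr {σ : Signature} (A : Set) where

  infixr 6 _∩ₑ_
  infixr 7 _×ₑ_
  data Expr : ℕ → Set₁ where
    ∅ₑ     : ∀ n → Expr n
    fullₑ  : ∀ n → Expr n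
    relₑ   : (R : RelSym σ) → Expr (rarity σ R)
    graphₑ : (F : FunSym σ) → Expr (suc (farity σ F))
    paramₑ : ∀ {n} → Rel A n → Expr n
    _∩ₑ_   : ∀ {n} → Expr n → Expr n → Expr n
    _×ₑ_   : ∀ {n k} → Expr n → Expr k → Expr (n + k)
    prₑ    : ∀ {n k} → Vec (Fin n) k → Expr n → Expr k

  -- (c, s, w) ↦ (c, w, s)
  rotate : ∀ m k → Vec (Fin (suc m + k)) (suc (k + m))
  rotate m k = Fin.zero ∷ (tabulate (suc m ↑ʳ_) ++ tabulate (λ i → Fin.suc i ↑ˡ k))

  -- (c, w, s) ↦ (c, s)
  dropMiddle : ∀ m k → Vec (Fin (suc (k + m))) (suc m)
  dropMiddle m k = Fin.zero ∷ tabulate (λ i → Fin.suc (k ↑ʳ i))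

  map-lookup-rotate : ∀ {C : Set} {m k} (c : C) (s : Vec C m) (w : Vec C k) →
                      V.map (lookup ((c ∷ s) ++ w)) (rotate m k) ≡ c ∷ (w ++ s)
  map-lookup-rotate {m = m} {k} c s w = cong (c ∷_) (trans (V.map-++ (lookup ((c ∷ s) ++ w)) (tabulate (suc m ↑ʳ_)) _)
    (cong₂ _++_ (map-lookup-tabulate _ ((c ∷ s) ++ w) w (V.lookup-++ʳ (c ∷ s) w))
                (map-lookup-tabulate _ ((c ∷ s) ++ w) s (V.lookup-++ˡ (c ∷ s) w ∘ Fin.suc))))

  map-lookup-dropMiddle : ∀ {C : Set} {m k} (c : C) (w : Vec C k) (s : Vec C m) →
                          V.map (lookup (c ∷ (w ++ s))) (dropMiddle m k) ≡ c ∷ s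
  map-lookup-dropMiddle c w s = cong (c ∷_) (map-lookup-tabulate _ (c ∷ (w ++ s)) s (V.lookup-++ʳ w s))

  graphFirst : (F : FunSym σ) → Expr (suc (farity σ F))
  graphFirst F = prₑ (lastFirst (farity σ F)) (graphₑ F)

  varGraph : ∀ {m} → Maybe (Fin m) → Expr (suc m)
  varGraph {m} (just i) = prₑ (i ∷ allFin m) (fullₑ m)
  varGraph {m} nothing = ∅ₑ (suc m)

  -- termGraph ns t = {(c, s) | t evaluates to c under the assignment s to ns}
  mutual
    termGraph : ∀ {m} → Vec ℕ m → Term σ → Expr (suc m)
    termGraph ns (var y) = varGraph (varIndex ns y)
    termGraph {m} ns (app F ts) =
      prₑ (dropMiddle m (farity σ F)) ((graphFirst F ×ₑ fullₑ m) ∩ₑ (fullₑ 1 ×ₑ termsGraph ns ts))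

    termsGraph : ∀ {m k} → Vec ℕ m → Vec (Term σ) k → Expr (k + m)
    termsGraph {m} ns [] = fullₑ m
    termsGraph {m} {suc k} ns (t ∷ ts) =
      prₑ (rotate m k) (termGraph ns t ×ₑ fullₑ k) ∩ₑ (fullₑ 1 ×ₑ termsGraph ns ts)

  eqExpr : ∀ {m} → Vec ℕ m → Term σ → Term σ → Expr m
  eqExpr {m} ns t t' = prₑ (tabulate Fin.suc) (termGraph ns t ∩ₑ termGraph ns t')

  relExpr : ∀ {m} → Vec ℕ m → (R : RelSym σ) → Vec (Term σ) (rarity σ R) → Expr m
  relExpr {m} ns R ts = prₑ (tabulate (rarity σ R ↑ʳ_)) (termsGraph ns ts ∩ₑ (relₑ R ×ₑ fullₑ m))

  projExpr : ∀ {m k} → Vec ℕ m → Rel A m → Vec ℕ k → Expr k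
  projExpr {m} {k} ns Y xs = prₑ (tabulate (_↑ˡ m)) (termsGraph ns (V.map var xs) ∩ₑ (fullₑ k ×ₑ paramₑ Y))

  -- (c, s) ↦ s[i ≔ c]
  updateIndex : ∀ {m} → Fin m → Fin m → Fin (suc m)
  updateIndex i j with i Fin.≟ j
  ... | yes _ = Fin.zero
  ... | no _ = Fin.suc j

  updateExpr : ∀ {m} → Fin m → A → Rel A m → Expr m
  updateExpr i a Y = prₑ (tabulate (updateIndex i)) (paramₑ (sing a) ×ₑ paramₑ Y)

  consExpr : ∀ {m} → A → Rel A m → Expr (suc m)
  consExpr a Y = paramₑ (sing a) ×ₑ paramₑ Y

  -- Reads an assignment to ns as one to v₀ … v_{N-1}: v_p takes the value of
  -- the name p in ns, or an arbitrary one from the padding if p does not occur.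
  cylinderIndex : ∀ {m N} → Maybe (Fin m) → Fin N → Fin (m + N)
  cylinderIndex {N = N} (just j) p = j ↑ˡ N
  cylinderIndex {m} nothing p = m ↑ʳ p

  cylinderIndices : ∀ {m} → Vec ℕ m → (N : ℕ) → Vec (Fin (m + N)) N
  cylinderIndices ns N = tabulate (λ p → cylinderIndex (varIndex ns (toℕ p)) p)

  cylinderExpr : ∀ {m} → Vec ℕ m → (N : ℕ) → Rel A m → Expr N
  cylinderExpr ns N Y = prₑ (cylinderIndices ns N) (paramₑ Y ×ₑ fullₑ N)

  module Interpret (𝔐 : Structure σ) (ρ : ∀ {n} → Rel A n → Rel (Carrier 𝔐) n) where
    open Semantics 𝔐
    open Locality 𝔐
    open Canonical 𝔐 using (teamOf; valueOf-tabulate)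
    private
      C = Carrier 𝔐

    ⟦_⟧ : ∀ {n} → Expr n → Rel C n
    ⟦ ∅ₑ n ⟧ = ∅
    ⟦ fullₑ n ⟧ = Full n
    ⟦ relₑ R ⟧ = relI 𝔐 R
    ⟦ graphₑ F ⟧ = Graph (funI 𝔐 F)
    ⟦ paramₑ X ⟧ = ρ X
    ⟦ E ∩ₑ E' ⟧ = ⟦ E ⟧ ∩ ⟦ E' ⟧
    ⟦ E ×ₑ E' ⟧ = ⟦ E ⟧ ×ʳ ⟦ E' ⟧
    ⟦ prₑ ı E ⟧ = Pr ı ⟦ E ⟧

    graphFirst-sound : ∀ F (c : C) w → ⟦ graphFirst F ⟧ (c ∷ w) → funI 𝔐 F w ≡ c
    graphFirst-sound F c w (v , Fv , e) with V.∷-injective (trans e (map-lookup-lastFirst v))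
    ... | refl , refl = Fv

    graphFirst-complete : ∀ F (c : C) w → funI 𝔐 F w ≡ c → ⟦ graphFirst F ⟧ (c ∷ w)
    graphFirst-complete F c w Fw≡c =
        w V.∷ʳ c
      , trans (cong (funI 𝔐 F) (V.init-∷ʳ c w)) (trans Fw≡c (sym (V.last-∷ʳ c w)))
      , sym (trans (map-lookup-lastFirst (w V.∷ʳ c)) (cong₂ _∷_ (V.last-∷ʳ c w) (V.init-∷ʳ c w)))

    varGraph-sound : ∀ {m} (r : Maybe (Fin m)) (c : C) s → ⟦ varGraph r ⟧ (c ∷ s) → Maybe.map (lookup s) r ≡ just c
    varGraph-sound (just i) c s (v , _ , e) with V.∷-injective e
    ... | refl , refl = cong (λ u → just (lookup u i)) (map-lookup-allFin v)

    varGraph-complete : ∀ {m} (r : Maybe (Fin m)) (c : C) s → Maybe.map (lookup s) r ≡ just c → ⟦ varGraph r ⟧ (c ∷ s)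
    varGraph-complete (just i) c s e = s , tt , cong₂ _∷_ (sym (just-injective e)) (sym (map-lookup-allFin s))

    mutual
      termGraph-sound : ∀ {m} (ns : Vec ℕ m) t (c : C) s → ⟦ termGraph ns t ⟧ (c ∷ s) → evalT ns s t ≡ just c
      termGraph-sound ns (var y) c s h = trans (evalT-var ns s y) (varGraph-sound (varIndex ns y) c s h)
      termGraph-sound ns (app F ts) c s (c' ∷ v , ((Fw≡c , _) , (_ , tsGraph)) , e) with V.splitAt (farity σ F) v
      ... | w , s' , refl with V.∷-injective (trans e (map-lookup-dropMiddle c' w s'))
      ... | refl , refl = trans (cong (Maybe.map (funI 𝔐 F)) (termsGraph-sound ns ts w s tsGraph))
                                (cong just (graphFirst-sound F c w Fw≡c))

      termGraph-complete : ∀ {m} (ns : Vec ℕ m) t (c : C) s → evalT ns s t ≡ just c → ⟦ termGraph ns t ⟧ (c ∷ s)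
      termGraph-complete ns (var y) c s e = varGraph-complete (varIndex ns y) c s (trans (sym (evalT-var ns s y)) e)
      termGraph-complete {m} ns (app F ts) c s e with evalTs ns s ts in e'
      ... | just w = c ∷ (w ++ s)
                   , ( ×ʳ-intro {P = ⟦ graphFirst F ⟧} {Q = Full m} (c ∷ w) s (graphFirst-complete F c w (just-injective e)) tt
                     , ×ʳ-intro {P = Full 1} {Q = ⟦ termsGraph ns ts ⟧} (c ∷ []) (w ++ s) tt (termsGraph-complete ns ts w s e'))
                   , sym (map-lookup-dropMiddle c w s)

      termsGraph-sound : ∀ {m k} (ns : Vec ℕ m) (ts : Vec (Term σ) k) (w : Vec C k) s →
                         ⟦ termsGraph ns ts ⟧ (w ++ s) → evalTs ns s ts ≡ just w
      termsGraph-sound ns [] [] s h = refl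
      termsGraph-sound {m} ns (t ∷ ts) (a ∷ w) s ((c ∷ v , (tGraph , _) , e) , (_ , tsGraph)) with V.splitAt m v
      ... | s' , w' , refl with V.∷-injective (trans e (map-lookup-rotate c s' w'))
      ... | refl , e₂ with V.++-injective w w' e₂
      ... | refl , refl = trans (evalTs-∷ ns s t ts)
                                (cong₂ consMaybe (termGraph-sound ns t a s tGraph) (termsGraph-sound ns ts w s tsGraph))

      termsGraph-complete : ∀ {m k} (ns : Vec ℕ m) (ts : Vec (Term σ) k) (w : Vec C k) s →
                            evalTs ns s ts ≡ just w → ⟦ termsGraph ns ts ⟧ (w ++ s)
      termsGraph-complete ns [] [] s e = tt
      termsGraph-complete {m} {suc k} ns (t ∷ ts) (a ∷ w) s e
        with consMaybe-inv (evalT ns s t) (evalTs ns s ts) (trans (sym (evalTs-∷ ns s t ts)) e)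
      ... | e₁ , e₂ = ( (a ∷ s) ++ w
                      , ×ʳ-intro {P = ⟦ termGraph ns t ⟧} {Q = Full k} (a ∷ s) w (termGraph-complete ns t a s e₁) tt
                      , sym (map-lookup-rotate a s w))
                    , ×ʳ-intro {P = Full 1} {Q = ⟦ termsGraph ns ts ⟧} (a ∷ []) (w ++ s) tt (termsGraph-complete ns ts w s e₂)

    sat-eqAt : ∀ {m} (ns : Vec ℕ m) (Y : Rel C m) t t' → Sat (team ns Y) (eqAt t t') ⇔ (Y ⊆ ⟦ eqExpr ns t t' ⟧)
    sat-eqAt ns Y t t' = mk⇔ (λ sat s → complete s ∘ sat s) (λ inc s → sound s ∘ inc s)
      where
      drop-head : ∀ (c : C) s → V.map (lookup (c ∷ s)) (tabulate Fin.suc) ≡ s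
      drop-head c s = map-lookup-tabulate Fin.suc (c ∷ s) s (λ _ → refl)
      sound : ∀ s → ⟦ eqExpr ns t t' ⟧ s → holdsEq (evalT ns s t) (evalT ns s t')
      sound s (c ∷ s' , (tc , t'c) , e) with trans e (drop-head c s')
      ... | refl = subst₂ holdsEq (sym (termGraph-sound ns t c s tc)) (sym (termGraph-sound ns t' c s t'c)) refl
      complete : ∀ s → holdsEq (evalT ns s t) (evalT ns s t') → ⟦ eqExpr ns t t' ⟧ s
      complete s h with evalT ns s t in e | evalT ns s t' in e'
      ... | just a | just b = a ∷ s , (termGraph-complete ns t a s e , termGraph-complete ns t' a s (trans e' (cong just (sym h))))
                            , sym (drop-head a s)

    sat-relAt : ∀ {m} (ns : Vec ℕ m) (Y : Rel C m) R ts → Sat (team ns Y) (relAt R ts) ⇔ (Y ⊆ ⟦ relExpr ns R ts ⟧)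
    sat-relAt {m} ns Y R ts = mk⇔ (λ sat s → complete s ∘ sat s) (λ inc s → sound s ∘ inc s)
      where
      k = rarity σ R
      drop-args : ∀ (w : Vec C k) s → V.map (lookup (w ++ s)) (tabulate (k ↑ʳ_)) ≡ s
      drop-args w s = map-lookup-++-↑ʳ w s
      sound : ∀ s → ⟦ relExpr ns R ts ⟧ s → holdsRel (relI 𝔐 R) (evalTs ns s ts)
      sound s (v , (tsGraph , Rw , _) , e) with V.splitAt k v
      ... | w , s' , refl with trans e (drop-args w s')
      ... | refl = subst (holdsRel (relI 𝔐 R)) (sym (termsGraph-sound ns ts w s tsGraph)) Rw
      complete : ∀ s → holdsRel (relI 𝔐 R) (evalTs ns s ts) → ⟦ relExpr ns R ts ⟧ s
      complete s h with evalTs ns s ts in e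
      ... | just w = w ++ s , (termsGraph-complete ns ts w s e , ×ʳ-intro {P = relI 𝔐 R} {Q = Full m} w s h tt)
                   , sym (drop-args w s)

    proj≐projExpr : ∀ {m k} (ns : Vec ℕ m) (Y : Rel A m) (xs : Vec ℕ k) → proj (team ns (ρ Y)) xs ≐ ⟦ projExpr ns Y xs ⟧
    proj≐projExpr {m} {k} ns Y xs = complete , sound
      where
      keep-vals : ∀ (u : Vec C k) (s : Vec C m) → V.map (lookup (u ++ s)) (tabulate (_↑ˡ m)) ≡ u
      keep-vals u s = map-lookup-tabulate _ (u ++ s) u (V.lookup-++ˡ u s)
      sound : ⟦ projExpr ns Y xs ⟧ ⊆ proj (team ns (ρ Y)) xs
      sound u (v , (graph , _ , Ys) , e) with V.splitAt k v
      ... | w , s , refl with trans e (keep-vals w s)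
      ... | refl = s , Ys , termsGraph-sound ns (V.map var xs) u s graph
      complete : proj (team ns (ρ Y)) xs ⊆ ⟦ projExpr ns Y xs ⟧
      complete u (s , Ys , e) = u ++ s , (termsGraph-complete ns (V.map var xs) u s e , ×ʳ-intro {P = Full k} {Q = ρ Y} u s tt Ys)
                              , sym (keep-vals u s)

    updateAt≐updateExpr : ∀ {m} (ns : Vec ℕ m) (i : Fin m) x a (c : C) (Y : Rel A m) → ρ (sing a) ≐ sing c →
                          Team.rel (updateAt (just i) ns (ρ Y) x c) ≐ ⟦ updateExpr i a Y ⟧
    updateAt≐updateExpr ns i x a c Y (a↦c , c↦a) = forth , back
      where
      map-updateIndex : ∀ s → V.map (lookup (c ∷ s)) (tabulate (updateIndex i)) ≡ s [ i ]≔ c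
      map-updateIndex s = map-lookup-tabulate _ (c ∷ s) (s [ i ]≔ c) lookup-updateIndex
        where
        lookup-updateIndex : ∀ j → lookup (c ∷ s) (updateIndex i j) ≡ lookup (s [ i ]≔ c) j
        lookup-updateIndex j with i Fin.≟ j
        ... | yes refl = sym (V.lookup∘update i s c)
        ... | no i≢j = sym (V.lookup∘update′ (i≢j ∘ sym) s c)
      forth : Team.rel (updateAt (just i) ns (ρ Y) x c) ⊆ ⟦ updateExpr i a Y ⟧
      forth t (s , Ys , refl) = c ∷ s , (c↦a (c ∷ []) refl , Ys) , sym (map-updateIndex s)
      back : ⟦ updateExpr i a Y ⟧ ⊆ Team.rel (updateAt (just i) ns (ρ Y) x c)
      back t (c' ∷ s , (ac' , Ys) , e) with a↦c (c' ∷ []) ac'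
      ... | refl = s , Ys , trans e (map-updateIndex s)

    updateAt≐consExpr : ∀ {m} (ns : Vec ℕ m) x a (c : C) (Y : Rel A m) → ρ (sing a) ≐ sing c →
                        Team.rel (updateAt nothing ns (ρ Y) x c) ≐ ⟦ consExpr a Y ⟧
    updateAt≐consExpr ns x a c Y (a↦c , c↦a) = (λ { (c' ∷ s) (Ys , refl) → c↦a (c ∷ []) refl , Ys })
                                             , (λ { (c' ∷ s) (ac' , Ys) → Ys , V.∷-injectiveˡ (a↦c (c' ∷ []) ac') })

    cylinder-≋ : ∀ {m} (ns : Vec ℕ m) N (Y : Rel A m) (c₀ : C) → (∀ {y} → InNames ns y → y < N) →
                 team ns (ρ Y) ≋[ InNames ns ] teamOf ⟦ cylinderExpr ns N Y ⟧
    cylinder-≋ {m} ns N Y c₀ bound = mk⊑ forth , mk⊑ back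
      where
      cylinder : Vec C (m + N) → Vec C N
      cylinder v = V.map (lookup v) (cylinderIndices ns N)
      lookup-cylinder : ∀ v p → lookup (cylinder v) p ≡ lookup v (cylinderIndex (varIndex ns (toℕ p)) p)
      lookup-cylinder v p = trans (V.lookup-map p (lookup v) (cylinderIndices ns N)) (cong (lookup v) (V.lookup∘tabulate _ p))
      agree : ∀ s r → Agree (InNames ns) ns s (tabulate toℕ) (cylinder (s ++ r))
      agree s r y (j , e) = begin
        valueOf ns s y                                              ≡⟨ cong (Maybe.map (lookup s)) e ⟩
        just (lookup s j)                                           ≡⟨ cong just (V.lookup-++ˡ s r j) ⟨
        just (lookup (s ++ r) (cylinderIndex (just j) p))           ≡⟨ cong (λ z → just (lookup (s ++ r) (cylinderIndex z p))) p↦j ⟨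
        just (lookup (s ++ r) (cylinderIndex (varIndex ns (toℕ p)) p)) ≡⟨ cong just (lookup-cylinder (s ++ r) p) ⟨
        just (lookup (cylinder (s ++ r)) p)                         ≡⟨ valueOf-tabulate (cylinder (s ++ r)) p (Fin.toℕ-fromℕ< y<N) ⟨
        valueOf (tabulate toℕ) (cylinder (s ++ r)) y                ∎
        where
        open ≡-Reasoning
        y<N = bound (j , e)
        p = Fin.fromℕ< y<N
        p↦j : varIndex ns (toℕ p) ≡ just j
        p↦j = trans (cong (varIndex ns) (Fin.toℕ-fromℕ< y<N)) e
      forth : ∀ s → ρ Y s → _
      forth s Ys = cylinder (s ++ V.replicate N c₀)
                 , (s ++ V.replicate N c₀ , ×ʳ-intro {P = ρ Y} {Q = Full N} s (V.replicate N c₀) Ys tt , refl)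
                 , agree s (V.replicate N c₀)
      back : ∀ t → ⟦ cylinderExpr ns N Y ⟧ t → _
      back t (v , (Ys , _) , refl) with V.splitAt m v
      ... | s , r , refl = s , Ys , λ y → sym ∘ agree s r y

module FromTarskiVaught (em : ExcludedMiddle 0ℓ) {σ : Signature} {𝔄 𝔅 : Structure σ} (f : TeamMap 𝔄 𝔅)
                        (embedding : IsTeamEmbedding f) (tv : TarskiVaught f) where
  open IsTeamEmbedding embedding
  open RelExpr {σ} (Carrier 𝔄)
  private
    A = Carrier 𝔄
    B = Carrier 𝔅
    fm : ∀ {n} → Rel A n → Rel B n
    fm = fmap f
    module SA = Semantics 𝔄
    module SB = Semantics 𝔅
    module LA = Locality 𝔄
    module LB = Locality 𝔅
    module CB = Canonical 𝔅
    module PB = Padding 𝔅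
    module IA = Interpret 𝔄 id
    module IB = Interpret 𝔅 fm

  fmap-mono : ∀ {n} {X Y : Rel A n} → X ⊆ Y → fm X ⊆ fm Y
  fmap-mono {X = X} {Y} = to (emb-incl X Y)

  fmap-∩ : ∀ {n} (X Y : Rel A n) → fm (X ∩ Y) ≐ (fm X ∩ fm Y)
  fmap-∩ X Y with Closed.cl-∩ (rangeClosed f) (X , ≐-refl) (Y , ≐-refl)
  ... | Z , fZ≐fX∩fY = (λ v h → fmap-mono (λ _ → proj₁) v h , fmap-mono (λ _ → proj₂) v h)
                     , (λ v → fmap-mono Z⊆X∩Y v ∘ proj₂ fZ≐fX∩fY v)
    where
    Z⊆X∩Y : Z ⊆ (X ∩ Y)
    Z⊆X∩Y u z = from (emb-incl Z X) (λ v → proj₁ ∘ proj₁ fZ≐fX∩fY v) u z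
              , from (emb-incl Z Y) (λ v → proj₂ ∘ proj₁ fZ≐fX∩fY v) u z

  fmap-⟦⟧ : ∀ {n} (E : Expr n) → fm IA.⟦ E ⟧ ≐ IB.⟦ E ⟧
  fmap-⟦⟧ (∅ₑ n) = (λ v → to (emb-empty (∅ {n = n})) (λ _ ()) v) , (λ v ())
  fmap-⟦⟧ (fullₑ n) = (λ _ _ → tt) , (λ v _ → to (emb-full (Full n)) (λ _ → tt) v)
  fmap-⟦⟧ (relₑ R) = emb-rel R
  fmap-⟦⟧ (graphₑ F) = emb-fun F
  fmap-⟦⟧ (paramₑ X) = ≐-refl
  fmap-⟦⟧ (E ∩ₑ E') = ≐-trans (fmap-∩ _ _) (∩-resp-≐ (fmap-⟦⟧ E) (fmap-⟦⟧ E'))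
  fmap-⟦⟧ (E ×ₑ E') = ≐-trans (emb-× _ _) (×ʳ-resp-≐ (fmap-⟦⟧ E) (fmap-⟦⟧ E'))
  fmap-⟦⟧ (prₑ ı E) = ≐-trans (emb-Pr ı _) (Pr-resp-≐ ı (fmap-⟦⟧ E))

  ⊆⟦⟧⇔ : ∀ {m} (X : Rel A m) (E : Expr m) → (X ⊆ IA.⟦ E ⟧) ⇔ (fm X ⊆ IB.⟦ E ⟧)
  ⊆⟦⟧⇔ X E = ⇔.trans (emb-incl X IA.⟦ E ⟧) (⊆-cong-≐ ≐-refl (fmap-⟦⟧ E))

  image : ∀ a → Σ B λ b → fm (sing a) ≐ sing b
  image a with to (emb-sing (sing a)) ((a ∷ []) , λ _ → id , id)
  ... | (b ∷ []) , fa≐b = b , IsSingletonOf⇒≐sing fa≐b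

  fmap-update-existing : ∀ {m} (ns : Vec ℕ m) X x (i : Fin m) a b → fm (sing a) ≐ sing b →
                      fm (SA.Team.rel (LA.updateAt (just i) ns X x a)) ≐ SB.Team.rel (LB.updateAt (just i) ns (fm X) x b)
  fmap-update-existing ns X x i a b fa≐b =
    ≐-trans (resp f (IA.updateAt≐updateExpr ns i x a a X ≐-refl))
            (≐-trans (fmap-⟦⟧ (updateExpr i a X)) (≐-sym (IB.updateAt≐updateExpr ns i x a b X fa≐b)))

  fmap-update-fresh : ∀ {m} (ns : Vec ℕ m) X x a b → fm (sing a) ≐ sing b →
                      fm (SA.Team.rel (LA.updateAt nothing ns X x a)) ≐ SB.Team.rel (LB.updateAt nothing ns (fm X) x b)
  fmap-update-fresh ns X x a b fa≐b =
    ≐-trans (resp f (IA.updateAt≐consExpr ns x a a X ≐-refl))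
            (≐-trans (fmap-⟦⟧ (consExpr a X)) (≐-sym (IB.updateAt≐consExpr ns x a b X fa≐b)))

  -- Over teams on arbitrary variable lists, since a quantifier may bind any variable.
  Preserved : Formula σ → Set₁
  Preserved φ = ∀ {m} (ns : Vec ℕ m) (X : Rel A m) → FreeIn (InNames ns) φ →
                SA.Sat (SA.team ns X) φ ⇔ SB.Sat (SB.team ns (fm X)) φ

  eqAt-preserved : ∀ t t' → Preserved (eqAt t t')
  eqAt-preserved t t' ns X _ =
    ⇔.trans (IA.sat-eqAt ns X t t') (⇔.trans (⊆⟦⟧⇔ X (eqExpr ns t t')) (⇔.sym (IB.sat-eqAt ns (fm X) t t')))

  relAt-preserved : ∀ R ts → Preserved (relAt R ts)
  relAt-preserved R ts ns X _ =
    ⇔.trans (IA.sat-relAt ns X R ts) (⇔.trans (⊆⟦⟧⇔ X (relExpr ns R ts)) (⇔.sym (IB.sat-relAt ns (fm X) R ts)))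

  fmap-proj : ∀ {m k} (ns : Vec ℕ m) X (xs : Vec ℕ k) → fm (SA.proj (SA.team ns X) xs) ≐ SB.proj (SB.team ns (fm X)) xs
  fmap-proj ns X xs = ≐-trans (resp f (IA.proj≐projExpr ns X xs))
                              (≐-trans (fmap-⟦⟧ (projExpr ns X xs)) (≐-sym (IB.proj≐projExpr ns X xs)))

  incl-preserved : ∀ {k} (xs ys : Vec ℕ k) → Preserved (incl xs ys)
  incl-preserved xs ys ns X _ = ⇔.trans (emb-incl _ _) (⊆-cong-≐ (fmap-proj ns X xs) (fmap-proj ns X ys))

  dep-preserved : ∀ {k} (xs : Vec ℕ k) → Preserved (dep xs)
  dep-preserved xs ns X _ = ⇔.trans (subsingleton⇔empty⊎singleton em _)
    (⇔.trans (emb-empty _ ⊎-⇔ emb-sing _)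
             (⇔.trans (⇔.sym (subsingleton⇔empty⊎singleton em _)) (IsSubsingleton-cong-≐ (fmap-proj ns X xs))))

  neg-preserved : ∀ {φ} → Preserved φ → Preserved (neg φ)
  neg-preserved IH ns X fv = emb-empty X ⊎-⇔ ¬-cong-⇔ (IH ns X fv)

  update-preserved : ∀ {φ} → Preserved φ → ∀ {m} (ns : Vec ℕ m) X x a b → fm (sing a) ≐ sing b →
                     FreeIn (λ y → y ≡ x ⊎ InNames ns y) φ →
                     SA.Sat (SA.update (SA.team ns X) x a) φ ⇔ SB.Sat (SB.update (SB.team ns (fm X)) x b) φ
  update-preserved {φ} IH {m} ns X x a b fa≐b fv
    rewrite LA.update≡updateAt ns X x a | LB.update≡updateAt ns (fm X) x b = go (varIndex ns x) refl
    where
    go : ∀ r → varIndex ns x ≡ r → SA.Sat (LA.updateAt r ns X x a) φ ⇔ SB.Sat (LB.updateAt r ns (fm X) x b) φ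
    go (just i) e = ⇔.trans (IH ns _ (FreeIn-mono Sum.[ (λ { refl → i , e }) , id ] φ fv))
                            (LB.Sat-cong-≐ ns φ (fmap-update-existing ns X x i a b fa≐b))
    go nothing e = ⇔.trans (IH (x ∷ ns) _ (FreeIn-mono (InNames-∷ ns x) φ fv))
                           (LB.Sat-cong-≐ (x ∷ ns) φ (fmap-update-fresh ns X x a b fa≐b))

  tarskiVaught-team : ∀ {φ m} (ns : Vec ℕ m) X x → FreeIn (λ y → y ≡ x ⊎ InNames ns y) φ →
                      SB.Sat (SB.team ns (fm X)) (ex1 x φ) →
                      Σ A λ a → Σ B λ b → fm (sing a) ≐ sing b × SB.Sat (SB.update (SB.team ns (fm X)) x b) φ
  tarskiVaught-team {φ} ns X x fv sat@(b₀ , _) with freshBound ns x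
  ... | N , x<N , bound = unpadded (tv N (PB.padded N x φ) fv-padded Y padded-sat)
    where
    N≢x : ¬ N ≡ x
    N≢x N≡x = ℕ.<-irrefl (sym N≡x) x<N
    Y : Rel A N
    Y = IA.⟦ cylinderExpr ns N X ⟧
    cylinder : SB.team ns (fm X) LB.≋[ InNames ns ] CB.teamOf (fm Y)
    cylinder = LB.≋-trans (IB.cylinder-≋ ns N X b₀ bound) (LB.≋-≐ _ (≐-sym (fmap-⟦⟧ (cylinderExpr ns N X))))
    padded-sat : 𝔅 ⊨[ fm Y ] ex1 N (PB.padded N x φ)
    padded-sat = PB.pad (CB.teamOf (fm Y)) x N φ N≢x (λ iy y≡N → ℕ.<-irrefl y≡N (bound iy)) fv
                        (LB.locality (ex1 x φ) fv cylinder sat)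
    fv-padded : FreeBelow (suc N) (PB.padded N x φ)
    fv-padded = (inj₁ refl , inj₂ (<⇒Below (ℕ.n<1+n N))) , FreeIn-mono (Sum.map₂ (<⇒Below ∘ ℕ.m<n⇒m<1+n ∘ bound)) φ fv
    unpadded : (Σ A λ a → Σ B λ b → IsSingletonOf (fm (sing a)) (b ∷ []) × 𝔅 ⊨[ fm Y ×ʳ sing b ] PB.padded N x φ) →
               Σ A λ a → Σ B λ b → fm (sing a) ≐ sing b × SB.Sat (SB.update (SB.team ns (fm X)) x b) φ
    unpadded (a , b , fa≐b , c , sat-c) =
      a , b , IsSingletonOf⇒≐sing fa≐b ,
      PB.unpad (CB.teamOf (fm Y ×ʳ sing b)) (SB.team ns (fm X)) x N c b φ N≢x
               (LB.≋-trans (LB.≋-mono (<⇒Below ∘ bound) (CB.×ʳ-sing-≋ (fm Y) b)) (LB.≋-sym cylinder))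
               (CB.valueOf-×ʳ-sing (fm Y) b) fv sat-c

  ∃-preserved : ∀ {φ} x → Preserved φ → Preserved (ex1 x φ)
  ∃-preserved x IH ns X fv = mk⇔
    (λ (a , h) → let b , fa≐b = image a in b , to (update-preserved IH ns X x a b fa≐b fv) h)
    (λ sat → let a , b , fa≐b , h = tarskiVaught-team ns X x fv sat in a , from (update-preserved IH ns X x a b fa≐b fv) h)

  -- If φ failed in 𝔅 at some b, the ∃-case for ∼φ would give a in 𝔄 at which
  -- φ fails too, or X is empty; the latter makes φ at b follow from φ at f(a).
  ∀-preserved : ∀ {φ} x → Preserved φ → Preserved (all1 x φ)
  ∀-preserved {φ} x IH ns X fv = mk⇔ forth back
    where
    T = SB.team ns (fm X)
    back : SB.Sat T (all1 x φ) → SA.Sat (SA.team ns X) (all1 x φ)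
    back h a = let b , fa≐b = image a in from (update-preserved IH ns X x a b fa≐b fv) (h b)
    refute : SA.Sat (SA.team ns X) (all1 x φ) → ∀ b → SA.Sat (SA.team ns X) (ex1 x (neg φ)) → ¬ ¬ SB.Sat (SB.update T x b) φ
    refute h b (a , inj₂ ¬satA) _ = ¬satA (h a)
    refute h b (a , inj₁ Xa-empty) ¬sat =
      ¬sat (LB.locality φ fv (LB.≋-empty (empty b') (empty b)) (to (update-preserved IH ns X x a b' fa≐b' fv) (h a)))
      where
      b' = proj₁ (image a)
      fa≐b' = proj₂ (image a)
      empty : ∀ c → IsEmpty (SB.Team.rel (SB.update T x c))
      empty c = LB.IsEmpty-update T x c (to (emb-empty X) (LA.IsEmpty-update⁻¹ (SA.team ns X) x a Xa-empty))
    forth : SA.Sat (SA.team ns X) (all1 x φ) → SB.Sat T (all1 x φ)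
    forth h b = decidable-stable em λ ¬sat →
      refute h b (from (∃-preserved {neg φ} x (neg-preserved IH) ns X fv) (b , inj₂ ¬sat)) ¬sat

  preserved : ∀ φ → Preserved φ
  preserved (eqAt t t') = eqAt-preserved t t'
  preserved (relAt R ts) = relAt-preserved R ts
  preserved (incl xs ys) = incl-preserved xs ys
  preserved (dep xs) = dep-preserved xs
  preserved (neg φ) = neg-preserved (preserved φ)
  preserved (conj φ ψ) ns X (fφ , fψ) = preserved φ ns X fφ ×-⇔ preserved ψ ns X fψ
  preserved (disj φ ψ) ns X (fφ , fψ) = preserved φ ns X fφ ⊎-⇔ preserved ψ ns X fψ
  preserved (ex1 x φ) = ∃-preserved x (preserved φ)
  preserved (all1 x φ) = ∀-preserved x (preserved φ)

  isElementary : IsElementaryTeamEmbedding f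
  isElementary = record
    { el-×   = emb-×
    ; el-sat = λ n φ fv X → preserved φ (tabulate toℕ) X (FreeIn-mono Below⇒InNames φ fv)
    }

mainTheorem11 : ExcludedMiddle 0ℓ → ExcludedMiddle (lsuc 0ℓ) →
    {σ : Signature} (𝔄 𝔅 : Structure σ) (f : TeamMap 𝔄 𝔅) →
    IsElementaryTeamEmbedding f ⇔ (IsTeamEmbedding f × TarskiVaught f)
mainTheorem11 em _ 𝔄 𝔅 f = mk⇔
  (λ elementary → FromElementary.isTeamEmbedding em f elementary , FromElementary.tarskiVaught em f elementary)
  (λ (embedding , tv) → FromTarskiVaught.isElementary em f embedding tv)
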